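{- For all odd integers $m,n\ge 3$, $\chi_{la}(C_m\vee K_n)=n+3$.
   Context: For a graph $G=(V,E)$, a local antimagic labeling is a bijection $f:E\to\{1,\dots,|E|\}$ such that, with $f^+(u)=\sum_{e\ni u} f(e)$, adjacent vertices receive distinct values of $f^+$; $c(f)$ is the number of distinct values of $f^+$ and $\chi_{la}(G)=\min c(f)$ over all local antimagic labelings. $C_m$ is the cycle on $m$ vertices, $K_n$ the complete graph on $n$ vertices, and $G\vee H$ the join (disjoint union plus all edges between $V(G)$ and $V(H)$). -}

module Defs where

open import Data.Nat using (ℕ; zero; suc; _+_; _<_; _≤_)
import Data.Nat as ℕ
open import Data.Fin using (Fin; toℕ; fromℕ<; _↑ˡ_; _↑ʳ_)
import Data.Fin as F
open import Data.List using (List; []; _∷_; map; _++_; length; lookup; allFin; concatMap; filter; deduplicate; cartesianProduct)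
open import Data.Nat.ListAction using (sum)
open import Data.Product using (_×_; _,_; proj₁; proj₂; Σ; ∃)
open import Data.Sum using (_⊎_)
open import Data.Bool using (if_then_else_; _∨_)
open import Relation.Nullary using (yes; no; ¬_)
open import Relation.Nullary.Decidable using (⌊_⌋)
open import Relation.Binary.PropositionalEquality using (_≡_; _≢_)
open import Function.Definitions using (Bijective)

-- A finite graph given by its vertex set Fin V and an explicit list of
-- edges (each edge an unordered pair, recorded as an ordered pair of ends).
record Graph : Set where
  constructor graph
  field
    V     : ℕ
    edges : List (Fin V × Fin V)

open Graph public

Odd : ℕ → Set
Odd m = ∃ λ k → m ≡ suc (2 ℕ.* k)

numE : Graph → ℕ
numE G = length (edges G)

Edge : Graph → Set
Edge G = Fin (numE G)

ends : (G : Graph) → Edge G → Fin (V G) × Fin (V G)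
ends G e = lookup (edges G) e

Adjacent : (G : Graph) → Fin (V G) → Fin (V G) → Set
Adjacent G u v = ∃ λ e → (ends G e ≡ (u , v)) ⊎ (ends G e ≡ (v , u))

-- an edge labeling is a bijection E → {1,…,|E|}; we encode {1,…,|E|}
-- as Fin |E| with the label of e being 1 + toℕ (f e).
Labeling : Graph → Set
Labeling G = Edge G → Fin (numE G)

label : (G : Graph) → Labeling G → Edge G → ℕ
label G f e = suc (toℕ (f e))

incident : (G : Graph) → Fin (V G) → Edge G → Data.Bool.Bool
incident G u e = ⌊ proj₁ (ends G e) F.≟ u ⌋ ∨ ⌊ proj₂ (ends G e) F.≟ u ⌋

fplus : (G : Graph) → Labeling G → Fin (V G) → ℕ
fplus G f u = sum (map (λ e → if incident G u e then label G f e else 0) (allFin (numE G)))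

IsLocalAntimagic : (G : Graph) → Labeling G → Set
IsLocalAntimagic G f =
  Bijective _≡_ _≡_ f ×
  (∀ u v → Adjacent G u v → fplus G f u ≢ fplus G f v)

colours : (G : Graph) → Labeling G → ℕ
colours G f = length (deduplicate ℕ._≟_ (map (fplus G f) (allFin (V G))))

χla≡ : Graph → ℕ → Set
χla≡ G k =
  (Σ (Labeling G) λ f → IsLocalAntimagic G f × colours G f ≡ k) ×
  (∀ (f : Labeling G) → IsLocalAntimagic G f → k ≤ colours G f)

next : ∀ {m} → Fin m → Fin m
next {suc k} i with suc (toℕ i) ℕ.<? suc k
... | yes p = fromℕ< p
... | no _  = F.zero

Cycle : ℕ → Graph
Cycle m = graph m (map (λ i → i , next i) (allFin m))

Complete : ℕ → Graph
Complete n = graph n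
  (concatMap (λ i → map (λ j → i , j) (filter (λ j → i F.<? j) (allFin n))) (allFin n))

Join : Graph → Graph → Graph
Join G H = graph (V G + V H)
  (map (λ p → (proj₁ p ↑ˡ V H) , (proj₂ p ↑ˡ V H)) (edges G) ++
   map (λ p → (V G ↑ʳ proj₁ p) , (V G ↑ʳ proj₂ p)) (edges H) ++
   map (λ p → (proj₁ p ↑ˡ V H) , (V G ↑ʳ proj₂ p)) (cartesianProduct (allFin (V G)) (allFin (V H))))

module Submission where

-- In a local antimagic labeling adjacent vertices have distinct
-- vertex sums, so the sums form a proper colouring.  The odd cycle C_m needs
-- three colours, the n clique vertices need n pairwise distinct colours, and
-- since every cycle vertex is joined to every clique vertex no colour is shared
-- between the two sides: at least n + 3 values (module LowerBound).
--
-- Write m = 2a + 1 and n = 2b + 1.  We label the cycle edges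
-- with 1 … m so that the two cycle labels at a vertex add up to one of three
-- numbers, the join edges with the next mn labels arranged so that every cycle
-- vertex receives the same join total, and the clique edges with the largest
-- labels (module Construction).  Then cycle vertices show three sums, the clique
-- sums strictly increase along K_n and all exceed the cycle sums, so the
-- labeling is local antimagic with n + 3 colours (module Separation).

open import Defs
open import Data.Nat using (ℕ; zero; suc; _+_; _*_; _∸_; _≤_; _<_; z≤n; s≤s; ⌊_/2⌋)
import Data.Nat as ℕ
open import Data.Nat.Properties
open import Data.Nat.DivMod using (m%n<n; m<n⇒m%n≡m)
open import Data.Nat.ListAction using (sum)
open import Data.Nat.ListAction.Properties using (sum-++)
open import Data.Nat.Tactic.RingSolver using (solve-∀)
open import Data.Bool using (Bool; true; false; if_then_else_; not; T; _∨_)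
open import Data.Bool.Properties using (not-involutive; if-eta; if-swap-then; ∨-identityʳ)
open import Data.Unit using (tt)
open import Data.Fin using (Fin; toℕ; fromℕ<; _↑ˡ_; _↑ʳ_; splitAt)
import Data.Fin as F
import Data.Fin.Properties as FP
open import Data.List using (List; []; _∷_; map; _++_; length; lookup; allFin; concatMap; filter; cartesianProduct; tabulate; deduplicate)
open import Data.List.Properties using (map-++; map-∘; length-tabulate)
open import Data.List.Membership.Propositional using (_∈_)
open import Data.List.Membership.Propositional.Properties
open import Data.List.Relation.Unary.Any as Any using (Any; here; there)
open import Data.List.Relation.Unary.Any.Properties using (lookup-index)
open import Data.List.Relation.Unary.All as All using (All; _∷_)
import Data.List.Relation.Unary.All.Properties as AllP
open import Data.List.Relation.Unary.AllPairs using (_∷_)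
import Data.List.Relation.Unary.AllPairs.Properties as AllPairsP
open import Data.List.Relation.Unary.Unique.Propositional using (Unique)
import Data.List.Relation.Unary.Unique.Propositional.Properties as UniqueP
open import Data.List.Relation.Unary.Unique.DecPropositional.Properties using (deduplicate-!)
open import Data.List.Relation.Binary.Disjoint.Propositional using (Disjoint)
open import Data.Product using (_×_; _,_; proj₁; proj₂; ∃)
open import Data.Sum using (_⊎_; inj₁; inj₂)
open import Data.Empty using (⊥; ⊥-elim)
open import Relation.Nullary using (Dec; yes; no; does; ¬_)
open import Relation.Nullary.Decidable using (_×-dec_; ¬?; isYes≗does)
open import Relation.Unary using (Decidable)
open import Relation.Binary.PropositionalEquality
open import Relation.Binary.Definitions using (tri<; tri≈; tri>)
open import Function.Definitions using (Bijective)
open import Algebra.Properties.Semiring.Sum +-*-semiring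
  using (sum-syntax; sum-cong-≗; ∑-distrib-+; ∑-comm; sum-replicate-zero) renaming (sum to ∑)

sumOver : {A : Set} → List A → (A → ℕ) → ℕ
sumOver xs g = sum (map g xs)

sumOver-++ : ∀ {A : Set} (xs ys : List A) g → sumOver (xs ++ ys) g ≡ sumOver xs g + sumOver ys g
sumOver-++ xs ys g = trans (cong sum (map-++ g xs ys)) (sum-++ (map g xs) (map g ys))

sumOver-map : ∀ {A B : Set} (h : A → B) (xs : List A) g → sumOver (map h xs) g ≡ sumOver xs (λ x → g (h x))
sumOver-map h xs g = cong sum (sym (map-∘ xs))

length≡sumOver-1 : ∀ {A : Set} (xs : List A) → length xs ≡ sumOver xs (λ _ → 1)
length≡sumOver-1 [] = refl
length≡sumOver-1 (x ∷ xs) = cong suc (length≡sumOver-1 xs)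

sumOver-concatMap : ∀ {A B : Set} (k : A → List B) (xs : List A) g →
  sumOver (concatMap k xs) g ≡ sumOver xs (λ x → sumOver (k x) g)
sumOver-concatMap k [] g = refl
sumOver-concatMap k (x ∷ xs) g =
  trans (sumOver-++ (k x) (concatMap k xs) g) (cong (sumOver (k x) g +_) (sumOver-concatMap k xs g))

sumOver-cartesianProduct : ∀ {A B : Set} (xs : List A) (ys : List B) g →
  sumOver (cartesianProduct xs ys) g ≡ sumOver xs (λ x → sumOver ys (λ y → g (x , y)))
sumOver-cartesianProduct [] ys g = refl
sumOver-cartesianProduct (x ∷ xs) ys g =
  trans (sumOver-++ (map (x ,_) ys) (cartesianProduct xs ys) g)
        (cong₂ _+_ (sumOver-map (x ,_) ys g) (sumOver-cartesianProduct xs ys g))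

sumOver-filter : ∀ {A : Set} {P : A → Set} (P? : Decidable P) (xs : List A) g →
  sumOver (filter P? xs) g ≡ sumOver xs (λ x → if does (P? x) then g x else 0)
sumOver-filter P? [] g = refl
sumOver-filter P? (x ∷ xs) g with does (P? x)
... | true = cong (g x +_) (sumOver-filter P? xs g)
... | false = sumOver-filter P? xs g

sumOver-tabulate : ∀ {A : Set} {n} (h : Fin n → A) g → sumOver (tabulate h) g ≡ ∑ (λ i → g (h i))
sumOver-tabulate {n = zero} h g = refl
sumOver-tabulate {n = suc n} h g = cong (g (h F.zero) +_) (sumOver-tabulate (λ i → h (F.suc i)) g)

sumOver-allFin : ∀ n g → sumOver (allFin n) g ≡ ∑ g
sumOver-allFin n g = sumOver-tabulate (λ i → i) g

∑-lookup : ∀ {A : Set} (xs : List A) (g : A → ℕ) → ∑ (λ e → g (lookup xs e)) ≡ sumOver xs g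
∑-lookup [] g = refl
∑-lookup (x ∷ xs) g = cong (g x +_) (∑-lookup xs g)

∑-zero : ∀ n → ∑ {n} (λ _ → 0) ≡ 0
∑-zero n = sum-replicate-zero n

∑-const : ∀ n c → ∑ {n} (λ _ → c) ≡ n * c
∑-const zero c = refl
∑-const (suc n) c = cong (c +_) (∑-const n c)

∑-mono-≤ : ∀ {n} {g g' : Fin n → ℕ} → (∀ x → g x ≤ g' x) → ∑ g ≤ ∑ g'
∑-mono-≤ {zero} le = z≤n
∑-mono-≤ {suc n} le = +-mono-≤ (le F.zero) (∑-mono-≤ (λ x → le (F.suc x)))

∑-mono-< : ∀ {n} {g g' : Fin (suc n) → ℕ} → (∀ x → g x < g' x) → ∑ g < ∑ g'
∑-mono-< le = +-mono-<-≤ (le F.zero) (∑-mono-≤ (λ x → <⇒≤ (le (F.suc x))))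

does-⇔ : ∀ {P Q : Set} → (P → Q) → (Q → P) → (d : Dec P) (e : Dec Q) → does d ≡ does e
does-⇔ f g (yes p) (yes q) = refl
does-⇔ f g (yes p) (no ¬q) = ⊥-elim (¬q (f p))
does-⇔ f g (no ¬p) (yes q) = ⊥-elim (¬p (g q))
does-⇔ f g (no ¬p) (no ¬q) = refl

does-no : ∀ {P : Set} → ¬ P → (d : Dec P) → does d ≡ false
does-no ¬p (yes p) = ⊥-elim (¬p p)
does-no ¬p (no _) = refl

does-yes : ∀ {P : Set} → P → (d : Dec P) → does d ≡ true
does-yes p (yes _) = refl
does-yes p (no ¬p) = ⊥-elim (¬p p)

∑-pick : ∀ {n} (j : Fin n) (g : Fin n → ℕ) → ∑ (λ y → if does (y F.≟ j) then g y else 0) ≡ g j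
∑-pick {suc n} F.zero g = trans (cong (g F.zero +_) (∑-zero n)) (+-identityʳ _)
∑-pick {suc n} (F.suc j) g = ∑-pick j (λ y → g (F.suc y))

∑-pickℕ : ∀ {n} s → s < n → (w : ℕ) → ∑[ x < n ] (if does (toℕ x ℕ.≟ s) then w else 0) ≡ w
∑-pickℕ {suc n} zero _ w = trans (cong (w +_) (∑-zero n)) (+-identityʳ w)
∑-pickℕ {suc n} (suc s) (s≤s lt) w = ∑-pickℕ s lt w

∑-below : ∀ {p} t → t ≤ p → ∑[ x < p ] (if does (toℕ x ℕ.<? t) then 1 else 0) ≡ t
∑-below {p} zero _ =
  trans (sum-cong-≗ {p} (λ x → cong (λ b → if b then 1 else 0) (does-no (λ ()) (toℕ x ℕ.<? 0)))) (∑-zero p)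
∑-below {suc p} (suc t) (s≤s le) = cong suc (∑-below t le)

∑-if : ∀ {n} (b : Bool) (g : Fin n → ℕ) → ∑ (λ y → if b then g y else 0) ≡ (if b then ∑ g else 0)
∑-if true g = refl
∑-if {n} false g = ∑-zero n

∑ℕ : ℕ → (ℕ → ℕ) → ℕ
∑ℕ n g = ∑[ j < n ] g (toℕ j)

∑ℕ-+ : ∀ n f g → ∑ℕ n (λ j → f j + g j) ≡ ∑ℕ n f + ∑ℕ n g
∑ℕ-+ n f g = ∑-distrib-+ {n} (λ j → f (toℕ j)) (λ j → g (toℕ j))

∑ℕ-*ʳ : ∀ n g c → ∑ℕ n (λ j → g j * c) ≡ ∑ℕ n g * c
∑ℕ-*ʳ zero g c = refl
∑ℕ-*ʳ (suc n) g c = trans (cong (g 0 * c +_) (∑ℕ-*ʳ n (λ j → g (suc j)) c))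
                          (sym (*-distribʳ-+ c (g 0) (∑ℕ n (λ j → g (suc j)))))

tri : ℕ → ℕ
tri zero = 0
tri (suc y) = tri y + y

∑ℕ-id : ∀ n → ∑ℕ n (λ j → j) ≡ tri n
∑ℕ-id zero = refl
∑ℕ-id (suc n) = begin
  ∑ℕ n (λ j → 1 + j)                ≡⟨ ∑ℕ-+ n (λ _ → 1) (λ j → j) ⟩
  ∑ℕ n (λ _ → 1) + ∑ℕ n (λ j → j)   ≡⟨ cong₂ _+_ (trans (∑-const n 1) (*-identityʳ n)) (∑ℕ-id n) ⟩
  n + tri n                         ≡⟨ +-comm n (tri n) ⟩
  tri (suc n)                       ∎
  where open ≡-Reasoning

quotient-< : ∀ d {j j' r r'} → j < j' → r < d → j * d + r < j' * d + r'
quotient-< d {j} {j'} {r} {r'} j<j' r<d = begin-strict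
  j * d + r    <⟨ +-monoʳ-< (j * d) r<d ⟩
  j * d + d    ≡⟨ +-comm (j * d) d ⟩
  suc j * d    ≤⟨ *-monoˡ-≤ d j<j' ⟩
  j' * d       ≤⟨ m≤m+n (j' * d) r' ⟩
  j' * d + r'  ∎
  where open ≤-Reasoning

quotient-unique : ∀ d j j' r r' → r < d → r' < d → j * d + r ≡ j' * d + r' → j ≡ j'
quotient-unique d j j' r r' lt lt' eq with <-cmp j j'
... | tri< j<j' _ _ = ⊥-elim (<-irrefl eq (quotient-< d j<j' lt))
... | tri≈ _ e _ = e
... | tri> _ _ j'<j = ⊥-elim (<-irrefl (sym eq) (quotient-< d j'<j lt'))

lookup-injective : ∀ {A : Set} (xs : List A) → Unique xs → ∀ i j → lookup xs i ≡ lookup xs j → i ≡ j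
lookup-injective (x ∷ xs) (px ∷ u) F.zero F.zero eq = refl
lookup-injective (x ∷ xs) (px ∷ u) F.zero (F.suc j) eq = ⊥-elim (All.lookup px (∈-lookup j) eq)
lookup-injective (x ∷ xs) (px ∷ u) (F.suc i) F.zero eq = ⊥-elim (All.lookup px (∈-lookup i) (sym eq))
lookup-injective (x ∷ xs) (px ∷ u) (F.suc i) (F.suc j) eq = cong F.suc (lookup-injective xs u i j eq)

unique-length-≤ : ∀ {A : Set} (xs ys : List A) → Unique xs → (∀ {z} → z ∈ xs → z ∈ ys) →
  length xs ≤ length ys
unique-length-≤ xs ys u sub = FP.injective⇒≤ {f = position} position-injective
  where
  position : Fin (length xs) → Fin (length ys)
  position i = Any.index (sub (∈-lookup i))
  position-injective : ∀ {i j} → position i ≡ position j → i ≡ j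
  position-injective {i} {j} eq = lookup-injective xs u i j
    (trans (lookup-index (sub (∈-lookup i)))
      (trans (cong (lookup ys) eq) (sym (lookup-index (sub (∈-lookup j))))))

injective⇒surjective : ∀ {k} (g : Fin k → Fin k) → (∀ {x y} → g x ≡ g y → x ≡ y) →
  ∀ y → ∃ λ x → g x ≡ y
injective⇒surjective {zero} g inj ()
injective⇒surjective {suc k} g inj y with FP.any? (λ x → g x F.≟ y)
... | yes hit = hit
... | no miss = ⊥-elim (<-irrefl refl (FP.injective⇒≤ {f = squeeze} squeeze-injective))
  where
  -- if y is never hit, g factors injectively through Fin k with y punched out
  squeeze : Fin (suc k) → Fin k
  squeeze x = F.punchOut {i = y} {j = g x} (λ e → miss (x , sym e))
  squeeze-injective : ∀ {x x'} → squeeze x ≡ squeeze x' → x ≡ x'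
  squeeze-injective {x} {x'} e =
    inj (FP.punchOut-injective (λ e' → miss (x , sym e')) (λ e' → miss (x' , sym e')) e)

colours-≥ : ∀ G (f : Labeling G) (zs : List ℕ) → Unique zs →
  (∀ {z} → z ∈ zs → ∃ λ u → z ≡ fplus G f u) → length zs ≤ colours G f
colours-≥ G f zs zs-unique attained = unique-length-≤ zs _ zs-unique value∈
  where
  value∈ : ∀ {z} → z ∈ zs → z ∈ deduplicate ℕ._≟_ (map (fplus G f) (allFin (V G)))
  value∈ z∈ with attained z∈
  ... | u , refl = ∈-deduplicate⁺ ℕ._≟_ (∈-map⁺ (fplus G f) (∈-allFin u))

colours-≤ : ∀ G (f : Labeling G) (cand : List ℕ) → (∀ u → fplus G f u ∈ cand) →
  colours G f ≤ length cand
colours-≤ G f cand covered = unique-length-≤ _ cand (deduplicate-! ℕ._≟_ values) value∈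
  where
  values : List ℕ
  values = map (fplus G f) (allFin (V G))
  value∈ : ∀ {z} → z ∈ deduplicate ℕ._≟_ values → z ∈ cand
  value∈ z∈ with ∈-map⁻ (fplus G f) {xs = allFin (V G)} (∈-deduplicate⁻ {A = ℕ} ℕ._≟_ values z∈)
  ... | u , _ , refl = covered u

∈edges⇒adjacent : ∀ G {u v} → (u , v) ∈ edges G → Adjacent G u v
∈edges⇒adjacent G p = Any.index p , inj₁ (sym (lookup-index p))

even : ℕ → Bool
even zero = true
even (suc t) = not (even t)

even-double : ∀ a → even (2 * a) ≡ true
even-double zero = refl
even-double (suc a) = begin
  even (2 * suc a)             ≡⟨ cong even (*-suc 2 a) ⟩
  not (not (even (2 * a)))     ≡⟨ not-involutive (even (2 * a)) ⟩
  even (2 * a)                 ≡⟨ even-double a ⟩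
  true                         ∎
  where open ≡-Reasoning

twoColours-alternate : (c : ℕ → ℕ) (k : ℕ) → (∀ t → t < k → c t ≢ c (suc t)) →
  (∀ t → t ≤ k → c t ≡ c 0 ⊎ c t ≡ c 1) →
  ∀ t → t ≤ k → c t ≡ (if even t then c 0 else c 1)
twoColours-alternate c k proper twoColours zero _ = refl
twoColours-alternate c k proper twoColours (suc t) t<k
  with twoColours (suc t) t<k | even t | twoColours-alternate c k proper twoColours t (<⇒≤ t<k)
... | inj₁ e | true  | ih = ⊥-elim (proper t t<k (trans ih (sym e)))
... | inj₂ e | true  | ih = e
... | inj₁ e | false | ih = e
... | inj₂ e | false | ih = ⊥-elim (proper t t<k (trans ih (sym e)))

oddCycle-thirdColour : (c : ℕ → ℕ) (a : ℕ) → (∀ t → t < 2 * a → c t ≢ c (suc t)) →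
  c (2 * a) ≢ c 0 → ∃ λ t → t ≤ 2 * a × c t ≢ c 0 × c t ≢ c 1
oddCycle-thirdColour c a proper wrap with anyUpTo? third? (suc (2 * a))
  where
  third? : ∀ t → Dec (c t ≢ c 0 × c t ≢ c 1)
  third? t = ¬? (c t ℕ.≟ c 0) ×-dec ¬? (c t ℕ.≟ c 1)
... | yes (t , t<m , third) = t , ℕ.s≤s⁻¹ t<m , third
... | no none = ⊥-elim (wrap (begin
  c (2 * a)                                  ≡⟨ twoColours-alternate c (2 * a) proper twoColours (2 * a) ≤-refl ⟩
  (if even (2 * a) then c 0 else c 1)        ≡⟨ cong (λ b → if b then c 0 else c 1) (even-double a) ⟩
  c 0                                        ∎))
  where
  open ≡-Reasoning
  twoColours : ∀ t → t ≤ 2 * a → c t ≡ c 0 ⊎ c t ≡ c 1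
  twoColours t t≤ with c t ℕ.≟ c 0 | c t ℕ.≟ c 1
  ... | yes e | _ = inj₁ e
  ... | no _ | yes e = inj₂ e
  ... | no ≢0 | no ≢1 = ⊥-elim (none (t , s≤s t≤ , ≢0 , ≢1))

next-step : ∀ {K} (i : Fin (suc K)) → suc (toℕ i) < suc K → toℕ (next i) ≡ suc (toℕ i)
next-step {K} i lt with suc (toℕ i) ℕ.<? suc K
... | yes p = FP.toℕ-fromℕ< p
... | no ¬p = ⊥-elim (¬p lt)

next-wrap : ∀ {K} (i : Fin (suc K)) → toℕ i ≡ K → toℕ (next i) ≡ 0
next-wrap {K} i eq with suc (toℕ i) ℕ.<? suc K
... | yes p = ⊥-elim (<-irrefl eq (ℕ.s≤s⁻¹ p))
... | no ¬p = refl

prevℕ : ℕ → ℕ → ℕ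
prevℕ K zero = K
prevℕ K (suc t) = t

previous : ∀ {K} → Fin (suc K) → Fin (suc K)
previous {K} F.zero = F.fromℕ K
previous (F.suc i) = F.inject₁ i

toℕ-previous : ∀ {K} (i : Fin (suc K)) → toℕ (previous i) ≡ prevℕ K (toℕ i)
toℕ-previous {K} F.zero = FP.toℕ-fromℕ K
toℕ-previous (F.suc i) = FP.toℕ-inject₁ i

next-previous : ∀ {K} (i : Fin (suc K)) → next (previous i) ≡ i
next-previous {K} F.zero = FP.toℕ-injective (next-wrap (previous F.zero) (FP.toℕ-fromℕ K))
next-previous {K} (F.suc i) = FP.toℕ-injective (begin
  toℕ (next (F.inject₁ i))   ≡⟨ next-step (F.inject₁ i) (s≤s (subst (_< K) (sym (FP.toℕ-inject₁ i)) (FP.toℕ<n i))) ⟩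
  suc (toℕ (F.inject₁ i))    ≡⟨ cong suc (FP.toℕ-inject₁ i) ⟩
  toℕ (F.suc i)              ∎)
  where open ≡-Reasoning

previous-next : ∀ {K} (i : Fin (suc K)) → previous (next i) ≡ i
previous-next {K} i = FP.toℕ-injective (trans (toℕ-previous (next i)) (step (m≤n⇒m<n∨m≡n (ℕ.s≤s⁻¹ (FP.toℕ<n i)))))
  where
  step : toℕ i < K ⊎ toℕ i ≡ K → prevℕ K (toℕ (next i)) ≡ toℕ i
  step (inj₁ lt) = cong (prevℕ K) (next-step i (s≤s lt))
  step (inj₂ eq) = trans (cong (prevℕ K) (next-wrap i eq)) (sym eq)

next≡⇒≡previous : ∀ {K} {k i : Fin (suc K)} → next k ≡ i → k ≡ previous i
next≡⇒≡previous {k = k} refl = sym (previous-next k)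

previous≢ : ∀ {K} → 1 ≤ K → (i : Fin (suc K)) → previous i ≢ i
previous≢ K≥1 i eq with toℕ i | trans (sym (toℕ-previous i)) (cong toℕ eq)
... | zero | K≡0 = <-irrefl (sym K≡0) K≥1
... | suc t | t≡1+t = <-irrefl t≡1+t (n<1+n t)

C∨K : ℕ → ℕ → Graph
C∨K m n = Join (Cycle m) (Complete n)

cycleEdge∈ : ∀ m n (k : Fin m) → ((k ↑ˡ n) , (next k ↑ˡ n)) ∈ edges (C∨K m n)
cycleEdge∈ m n k = ∈-++⁺ˡ (∈-map⁺ _ (∈-map⁺ (λ i → i , next i) (∈-allFin k)))

cliqueEdge∈ : ∀ m n (x y : Fin n) → toℕ x < toℕ y → ((m ↑ʳ x) , (m ↑ʳ y)) ∈ edges (C∨K m n)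
cliqueEdge∈ m n x y x<y = ∈-++⁺ʳ (map _ (edges (Cycle m))) (∈-++⁺ˡ (∈-map⁺ _
  (∈-concatMap⁺ (λ i → map (i ,_) (filter (i F.<?_) (allFin n)))
    (Any.map (λ { refl → ∈-map⁺ (x ,_) (∈-filter⁺ (x F.<?_) (∈-allFin y) x<y) }) (∈-allFin x)))))

joinEdge∈ : ∀ m n (i : Fin m) (j : Fin n) → ((i ↑ˡ n) , (m ↑ʳ j)) ∈ edges (C∨K m n)
joinEdge∈ m n i j = ∈-++⁺ʳ (map _ (edges (Cycle m))) (∈-++⁺ʳ (map _ (edges (Complete n)))
  (∈-map⁺ _ (∈-cartesianProduct⁺ (∈-allFin i) (∈-allFin j))))

module LowerBound (a n : ℕ) (a≥1 : 1 ≤ a) where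

  m : ℕ
  m = suc (2 * a)

  G : Graph
  G = C∨K m n

  position : ℕ → Fin m
  position t = fromℕ< (m%n<n t m)

  cycleVertex : ℕ → Fin (m + n)
  cycleVertex t = position t ↑ˡ n

  toℕ-position : ∀ {t} → t < m → toℕ (position t) ≡ t
  toℕ-position {t} t<m = trans (FP.toℕ-fromℕ< (m%n<n t m)) (m<n⇒m%n≡m t<m)

  next-position : ∀ t → suc t < m → next (position t) ≡ position (suc t)
  next-position t st<m = FP.toℕ-injective (begin
    toℕ (next (position t))  ≡⟨ next-step (position t) (subst (λ s → suc s < m) (sym (toℕ-position t<m)) st<m) ⟩
    suc (toℕ (position t))   ≡⟨ cong suc (toℕ-position t<m) ⟩
    suc t                    ≡⟨ sym (toℕ-position st<m) ⟩
    toℕ (position (suc t))   ∎)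
    where
    open ≡-Reasoning
    t<m : t < m
    t<m = <-trans (n<1+n t) st<m

  next-position-last : next (position (2 * a)) ≡ position 0
  next-position-last = FP.toℕ-injective
    (trans (next-wrap (position (2 * a)) (toℕ-position ≤-refl)) (sym (toℕ-position (s≤s z≤n))))

  cycleEdge-adjacent : ∀ t → Adjacent G (cycleVertex t) (next (position t) ↑ˡ n)
  cycleEdge-adjacent t = ∈edges⇒adjacent G (cycleEdge∈ m n (position t))

  lowerBound : (f : Labeling G) → IsLocalAntimagic G f → n + 3 ≤ colours G f
  lowerBound f (_ , antimagic) =
    subst (_≤ colours G f) (trans (cong (3 +_) (length-tabulate K)) (+-comm 3 n))
      (colours-≥ G f values values-unique attained)
    where
    c : ℕ → ℕ
    c t = fplus G f (cycleVertex t)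

    proper : ∀ t → t < 2 * a → c t ≢ c (suc t)
    proper t t<2a = antimagic _ _ (subst (λ v → Adjacent G (cycleVertex t) (v ↑ˡ n))
      (next-position t (s≤s t<2a)) (cycleEdge-adjacent t))

    wrap : c (2 * a) ≢ c 0
    wrap = antimagic _ _ (subst (λ v → Adjacent G (cycleVertex (2 * a)) (v ↑ˡ n))
      next-position-last (cycleEdge-adjacent (2 * a)))

    c0≢c1 : c 0 ≢ c 1
    c0≢c1 = proper 0 (≤-trans (s≤s z≤n) (*-monoʳ-≤ 2 a≥1))

    third : ∃ λ t → t ≤ 2 * a × c t ≢ c 0 × c t ≢ c 1
    third = oddCycle-thirdColour c a proper wrap

    t₃ : ℕ
    t₃ = proj₁ third

    K : Fin n → ℕ
    K j = fplus G f (m ↑ʳ j)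

    K-injective : ∀ {j j'} → K j ≡ K j' → j ≡ j'
    K-injective {j} {j'} eq with <-cmp (toℕ j) (toℕ j')
    ... | tri< lt _ _ = ⊥-elim (antimagic _ _ (∈edges⇒adjacent G (cliqueEdge∈ m n j j' lt)) eq)
    ... | tri≈ _ e _ = FP.toℕ-injective e
    ... | tri> _ _ gt = ⊥-elim (antimagic _ _ (∈edges⇒adjacent G (cliqueEdge∈ m n j' j gt)) (sym eq))

    cycle≢clique : ∀ t j → c t ≢ K j
    cycle≢clique t j = antimagic _ _ (∈edges⇒adjacent G (joinEdge∈ m n (position t) j))

    values : List ℕ
    values = c 0 ∷ c 1 ∷ c t₃ ∷ tabulate K

    values-unique : Unique values
    values-unique =
      (c0≢c1 ∷ (λ e → proj₁ (proj₂ (proj₂ third)) (sym e)) ∷ AllP.tabulate⁺ (cycle≢clique 0))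
      ∷ ((λ e → proj₂ (proj₂ (proj₂ third)) (sym e)) ∷ AllP.tabulate⁺ (cycle≢clique 1))
      ∷ AllP.tabulate⁺ (cycle≢clique t₃)
      ∷ UniqueP.tabulate⁺ K-injective

    attained : ∀ {z} → z ∈ values → ∃ λ u → z ≡ fplus G f u
    attained (here refl) = cycleVertex 0 , refl
    attained (there (here refl)) = cycleVertex 1 , refl
    attained (there (there (here refl))) = cycleVertex t₃ , refl
    attained (there (there (there z∈))) with ∈-tabulate⁻ z∈
    ... | j , refl = m ↑ʳ j , refl

parity : ∀ t → ∃ λ s → t ≡ 2 * s ⊎ t ≡ suc (2 * s)
parity zero = 0 , inj₁ refl
parity (suc zero) = 0 , inj₂ refl
parity (suc (suc t)) with parity t
... | s , inj₁ refl = suc s , inj₁ (sym (*-suc 2 s))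
... | s , inj₂ refl = suc s , inj₂ (cong suc (sym (*-suc 2 s)))

⌊double/2⌋ : ∀ s → ⌊ 2 * s /2⌋ ≡ s
⌊double/2⌋ zero = refl
⌊double/2⌋ (suc s) = trans (cong ⌊_/2⌋ (*-suc 2 s)) (cong suc (⌊double/2⌋ s))

⌊suc-double/2⌋ : ∀ s → ⌊ suc (2 * s) /2⌋ ≡ s
⌊suc-double/2⌋ zero = refl
⌊suc-double/2⌋ (suc s) = trans (cong (λ t → ⌊ suc t /2⌋) (*-suc 2 s)) (cong suc (⌊suc-double/2⌋ s))

even-suc-double : ∀ s → even (suc (2 * s)) ≡ false
even-suc-double s = cong not (even-double s)

double≢suc-double : ∀ p q → 2 * p ≢ suc (2 * q)
double≢suc-double p q eq with trans (sym (even-double p)) (trans (cong even eq) (even-suc-double q))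
... | ()

<ᵇ-true : ∀ {i a} → i < a → (i ℕ.<ᵇ a) ≡ true
<ᵇ-true {i} {a} lt with i ℕ.<ᵇ a | <⇒<ᵇ lt
... | true | _ = refl

<ᵇ-false : ∀ {i a} → ¬ i < a → (i ℕ.<ᵇ a) ≡ false
<ᵇ-false {i} {a} nlt with i ℕ.<ᵇ a in eq
... | false = refl
... | true = ⊥-elim (nlt (<ᵇ⇒< i a (subst T (sym eq) tt)))

-- Labels on the cycle C_{2a+1}, counted from 0.  The edge from vertex t to t + 1
-- gets cycleLabel t: even positions 2s get s ∈ 0…a and odd positions 2s + 1 get
-- 2a − s ∈ a+1…2a, so every vertex sees one of only three label sums.
module CycleLabels (a : ℕ) where

  cycleLabel : ℕ → ℕ
  cycleLabel t = if even t then ⌊ t /2⌋ else 2 * a ∸ ⌊ t /2⌋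

  cycleLabel-even : ∀ s → cycleLabel (2 * s) ≡ s
  cycleLabel-even s rewrite even-double s = ⌊double/2⌋ s

  cycleLabel-odd : ∀ s → cycleLabel (suc (2 * s)) ≡ 2 * a ∸ s
  cycleLabel-odd s rewrite even-suc-double s | ⌊suc-double/2⌋ s = refl

  evenHalf≤ : ∀ s → 2 * s ≤ 2 * a → s ≤ a
  evenHalf≤ s le = *-cancelˡ-≤ 2 le

  oddHalf≤ : ∀ s → suc (2 * s) ≤ 2 * a → s ≤ 2 * a
  oddHalf≤ s le = ≤-trans (m≤m+n _ _) (<⇒≤ le)

  cycleLabel-≤ : ∀ t → t ≤ 2 * a → cycleLabel t ≤ 2 * a
  cycleLabel-≤ t le with parity t
  ... | s , inj₁ refl rewrite cycleLabel-even s = ≤-trans (m≤m+n s _) le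
  ... | s , inj₂ refl rewrite cycleLabel-odd s = m∸n≤m (2 * a) s

  oddLabel-> : ∀ s → suc (2 * s) ≤ 2 * a → a < 2 * a ∸ s
  oddLabel-> s le = m+n≤o⇒m≤o∸n (suc a) (begin
    suc a + s   ≡⟨ sym (+-suc a s) ⟩
    a + suc s   ≤⟨ +-monoʳ-≤ a (*-cancelˡ-< 2 s a le) ⟩
    a + a       ≡⟨ cong (a +_) (sym (+-identityʳ a)) ⟩
    2 * a       ∎)
    where open ≤-Reasoning

  cycleLabel-injective : ∀ {t t'} → t ≤ 2 * a → t' ≤ 2 * a → cycleLabel t ≡ cycleLabel t' → t ≡ t'
  cycleLabel-injective {t} {t'} le le' eq with parity t | parity t'
  ... | s , inj₁ refl | s' , inj₁ refl =
    cong (2 *_) (trans (sym (cycleLabel-even s)) (trans eq (cycleLabel-even s')))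
  ... | s , inj₂ refl | s' , inj₂ refl =
    cong (λ r → suc (2 * r)) (∸-cancelˡ-≡ (oddHalf≤ s le) (oddHalf≤ s' le')
      (trans (sym (cycleLabel-odd s)) (trans eq (cycleLabel-odd s'))))
  ... | s , inj₁ refl | s' , inj₂ refl =
    ⊥-elim (<-irrefl (trans (sym (cycleLabel-even s)) (trans eq (cycleLabel-odd s')))
                     (≤-<-trans (evenHalf≤ s le) (oddLabel-> s' le')))
  ... | s , inj₂ refl | s' , inj₁ refl =
    ⊥-elim (<-irrefl (trans (sym (cycleLabel-even s')) (trans (sym eq) (cycleLabel-odd s)))
                     (≤-<-trans (evenHalf≤ s' le') (oddLabel-> s le)))

  cycleColour : ℕ → ℕ
  cycleColour zero = a
  cycleColour (suc t) = if even t then 2 * a else suc (2 * a)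

  cycleLabel-sum : ∀ t → t ≤ 2 * a → cycleLabel t + cycleLabel (prevℕ (2 * a) t) ≡ cycleColour t
  cycleLabel-sum zero _ = cycleLabel-even a
  cycleLabel-sum (suc t) le with parity t
  ... | s , inj₁ refl = begin
    cycleLabel (suc (2 * s)) + cycleLabel (2 * s)   ≡⟨ cong₂ _+_ (cycleLabel-odd s) (cycleLabel-even s) ⟩
    2 * a ∸ s + s                                    ≡⟨ m∸n+n≡m (oddHalf≤ s le) ⟩
    2 * a                                            ≡⟨ cong (λ b → if b then 2 * a else suc (2 * a)) (sym (even-double s)) ⟩
    cycleColour (suc (2 * s))                        ∎
    where open ≡-Reasoning
  ... | s , inj₂ refl = begin
    cycleLabel (suc (suc (2 * s))) + cycleLabel (suc (2 * s))
      ≡⟨ cong₂ _+_ (trans (cong cycleLabel (sym (*-suc 2 s))) (cycleLabel-even (suc s))) (cycleLabel-odd s) ⟩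
    suc s + (2 * a ∸ s)   ≡⟨ cong suc (m+[n∸m]≡n (oddHalf≤ s (<⇒≤ le))) ⟩
    suc (2 * a)           ≡⟨ cong (λ b → if b then 2 * a else suc (2 * a)) (sym (even-suc-double s)) ⟩
    cycleColour (suc (suc (2 * s)))   ∎
    where open ≡-Reasoning

  cycleColour-values : ∀ t → cycleColour t ≡ a ⊎ cycleColour t ≡ 2 * a ⊎ cycleColour t ≡ suc (2 * a)
  cycleColour-values zero = inj₁ refl
  cycleColour-values (suc t) with even t
  ... | true = inj₂ (inj₁ refl)
  ... | false = inj₂ (inj₂ refl)

  cycleColour-≤ : ∀ t → cycleColour t ≤ suc (2 * a)
  cycleColour-≤ zero = ≤-trans (m≤m+n a _) (n≤1+n _)
  cycleColour-≤ (suc t) with even t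
  ... | true = n≤1+n _
  ... | false = ≤-refl

  module _ (a≥1 : 1 ≤ a) where

    a<2a : a < 2 * a
    a<2a = m<m+n a (subst (0 <_) (sym (+-identityʳ a)) a≥1)

    cycleColour-step : ∀ t → cycleColour t ≢ cycleColour (suc t)
    cycleColour-step zero eq = <-irrefl eq a<2a
    cycleColour-step (suc t) eq with even t
    ... | true = <-irrefl eq (n<1+n _)
    ... | false = <-irrefl (sym eq) (n<1+n _)

    cycleColour-wrap : cycleColour (2 * a) ≢ cycleColour 0
    cycleColour-wrap eq = <-irrefl (sym (trans (sym lastColour) eq)) (<-trans a<2a (n<1+n _))
      where
      a≡suc : a ≡ suc (a ∸ 1)
      a≡suc = sym (trans (+-comm 1 (a ∸ 1)) (m∸n+n≡m a≥1))
      lastColour : cycleColour (2 * a) ≡ suc (2 * a)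
      lastColour = begin
        cycleColour (2 * a)                   ≡⟨ cong (λ x → cycleColour (2 * x)) a≡suc ⟩
        cycleColour (2 * suc (a ∸ 1))         ≡⟨ cong cycleColour (*-suc 2 (a ∸ 1)) ⟩
        cycleColour (suc (suc (2 * (a ∸ 1)))) ≡⟨ cong (λ b → if b then 2 * a else suc (2 * a)) (even-suc-double (a ∸ 1)) ⟩
        suc (2 * a)                           ∎
        where open ≡-Reasoning

-- The edge between cycle vertex i ≤ 2a and clique
-- vertex j gets offset j i.  Each row j is a permutation of 0…2a, and every
-- column has the same sum over an odd number n ≥ 3 of rows: the first three
-- rows have column sums 3a, and the later rows come in pairs i, 2a − i.
module JoinOffsets (a : ℕ) where

  twice : 2 * a ≡ a + a
  twice = cong (a +_) (+-identityʳ a)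

  pairedRow : ℕ → ℕ → ℕ
  pairedRow zero i = i
  pairedRow (suc zero) i = 2 * a ∸ i
  pairedRow (suc (suc k)) i = pairedRow k i

  offset : ℕ → ℕ → ℕ
  offset zero i = i
  offset (suc zero) i = if i ℕ.<ᵇ a then i + suc a else i ∸ a
  offset (suc (suc zero)) i = if i ℕ.<ᵇ a then suc (2 * (a ∸ suc i)) else 2 * (2 * a ∸ i)
  offset (suc (suc (suc k))) i = pairedRow k i

  pairedRow-≤ : ∀ k i → i ≤ 2 * a → pairedRow k i ≤ 2 * a
  pairedRow-≤ zero i le = le
  pairedRow-≤ (suc zero) i le = m∸n≤m _ i
  pairedRow-≤ (suc (suc k)) i le = pairedRow-≤ k i le

  pairedRow-injective : ∀ k {i i'} → i ≤ 2 * a → i' ≤ 2 * a → pairedRow k i ≡ pairedRow k i' → i ≡ i'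
  pairedRow-injective zero le le' eq = eq
  pairedRow-injective (suc zero) le le' eq = ∸-cancelˡ-≡ le le' eq
  pairedRow-injective (suc (suc k)) = pairedRow-injective k

  ∸a≤a : ∀ {i} → i ≤ 2 * a → i ∸ a ≤ a
  ∸a≤a le = ≤-trans (∸-monoˡ-≤ a le) (≤-reflexive (trans (cong (_∸ a) twice) (m+n∸m≡n a a)))

  offset-≤ : ∀ j i → i ≤ 2 * a → offset j i ≤ 2 * a
  offset-≤ zero i le = le
  offset-≤ (suc zero) i le with i <? a
  ... | yes lt rewrite <ᵇ-true lt = begin
    i + suc a   ≡⟨ +-suc i a ⟩
    suc i + a   ≤⟨ +-monoˡ-≤ a lt ⟩
    a + a       ≡⟨ sym twice ⟩
    2 * a       ∎
    where open ≤-Reasoning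
  ... | no ¬lt rewrite <ᵇ-false ¬lt = ≤-trans (m∸n≤m i a) le
  offset-≤ (suc (suc zero)) i le with i <? a
  ... | yes lt rewrite <ᵇ-true lt = *-monoʳ-< 2 (subst (a ∸ suc i <_) (m∸n+n≡m lt) (m<m+n _ (s≤s z≤n)))
  ... | no ¬lt rewrite <ᵇ-false ¬lt =
    *-monoʳ-≤ 2 (≤-trans (∸-monoʳ-≤ (2 * a) (≮⇒≥ ¬lt)) (≤-reflexive (trans (cong (_∸ a) twice) (m+n∸m≡n a a))))
  offset-≤ (suc (suc (suc k))) i le = pairedRow-≤ k i le

  offset-injective : ∀ j {i i'} → i ≤ 2 * a → i' ≤ 2 * a → offset j i ≡ offset j i' → i ≡ i'
  offset-injective zero le le' eq = eq
  offset-injective (suc zero) {i} {i'} le le' eq with i <? a | i' <? a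
  ... | yes lt | yes lt' rewrite <ᵇ-true lt | <ᵇ-true lt' = +-cancelʳ-≡ (suc a) i i' eq
  ... | no ¬lt | no ¬lt' rewrite <ᵇ-false ¬lt | <ᵇ-false ¬lt' = ∸-cancelʳ-≡ (≮⇒≥ ¬lt) (≮⇒≥ ¬lt') eq
  ... | yes lt | no ¬lt' rewrite <ᵇ-true lt | <ᵇ-false ¬lt' =
    ⊥-elim (<-irrefl (sym eq) (<-≤-trans (s≤s (∸a≤a le')) (m≤n+m (suc a) i)))
  ... | no ¬lt | yes lt' rewrite <ᵇ-false ¬lt | <ᵇ-true lt' =
    ⊥-elim (<-irrefl eq (<-≤-trans (s≤s (∸a≤a le)) (m≤n+m (suc a) i')))
  offset-injective (suc (suc zero)) {i} {i'} le le' eq with i <? a | i' <? a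
  ... | yes lt | yes lt' rewrite <ᵇ-true lt | <ᵇ-true lt' =
    suc-injective (∸-cancelˡ-≡ lt lt' (*-cancelˡ-≡ _ _ 2 (suc-injective eq)))
  ... | no ¬lt | no ¬lt' rewrite <ᵇ-false ¬lt | <ᵇ-false ¬lt' = ∸-cancelˡ-≡ le le' (*-cancelˡ-≡ _ _ 2 eq)
  ... | yes lt | no ¬lt' rewrite <ᵇ-true lt | <ᵇ-false ¬lt' = ⊥-elim (double≢suc-double (2 * a ∸ i') (a ∸ suc i) (sym eq))
  ... | no ¬lt | yes lt' rewrite <ᵇ-false ¬lt | <ᵇ-true lt' = ⊥-elim (double≢suc-double (2 * a ∸ i) (a ∸ suc i') eq)
  offset-injective (suc (suc (suc k))) = pairedRow-injective k

  firstRows-sum : ∀ i → i ≤ 2 * a → i + (offset 1 i + offset 2 i) ≡ 3 * a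
  firstRows-sum i le with i <? a
  ... | yes lt rewrite <ᵇ-true lt = begin
    i + ((i + suc a) + suc (2 * d))                   ≡⟨ cong (λ x → i + ((i + suc x) + suc (2 * d))) (sym split) ⟩
    i + ((i + suc (d + suc i)) + suc (2 * d))         ≡⟨ identity i d ⟩
    3 * (d + suc i)                                   ≡⟨ cong (3 *_) split ⟩
    3 * a                                             ∎
    where
    open ≡-Reasoning
    d : ℕ
    d = a ∸ suc i
    split : d + suc i ≡ a
    split = m∸n+n≡m lt
    identity : ∀ i d → i + ((i + suc (d + suc i)) + suc (2 * d)) ≡ 3 * (d + suc i)
    identity = solve-∀
  ... | no ¬lt rewrite <ᵇ-false ¬lt = begin
    i + (s + 2 * t)                   ≡⟨ cong (λ x → x + (s + 2 * t)) (sym below) ⟩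
    s + a + (s + 2 * t)               ≡⟨ cong (λ x → s + x + (s + 2 * t)) (sym split) ⟩
    s + (t + s) + (s + 2 * t)         ≡⟨ identity s t ⟩
    3 * (t + s)                       ≡⟨ cong (3 *_) split ⟩
    3 * a                             ∎
    where
    open ≡-Reasoning
    s t : ℕ
    s = i ∸ a
    t = 2 * a ∸ i
    below : s + a ≡ i
    below = m∸n+n≡m (≮⇒≥ ¬lt)
    split : t + s ≡ a
    split = +-cancelʳ-≡ a (t + s) a (begin
      t + s + a     ≡⟨ +-assoc t s a ⟩
      t + (s + a)   ≡⟨ cong (t +_) below ⟩
      t + i         ≡⟨ m∸n+n≡m le ⟩
      2 * a         ≡⟨ twice ⟩
      a + a         ∎)
    identity : ∀ s t → s + (t + s) + (s + 2 * t) ≡ 3 * (t + s)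
    identity = solve-∀

  pairedRows-sum : ∀ k i → i ≤ 2 * a → ∑ℕ (2 * k) (λ j → pairedRow j i) ≡ k * (2 * a)
  pairedRows-sum zero i le = refl
  pairedRows-sum (suc k) i le = begin
    ∑ℕ (2 * suc k) (λ j → pairedRow j i)                      ≡⟨ cong (λ r → ∑ℕ r (λ j → pairedRow j i)) (*-suc 2 k) ⟩
    i + ((2 * a ∸ i) + ∑ℕ (2 * k) (λ j → pairedRow j i))      ≡⟨ sym (+-assoc i (2 * a ∸ i) _) ⟩
    i + (2 * a ∸ i) + ∑ℕ (2 * k) (λ j → pairedRow j i)        ≡⟨ cong₂ _+_ (m+[n∸m]≡n le) (pairedRows-sum k i le) ⟩
    2 * a + k * (2 * a)                                       ∎
    where open ≡-Reasoning

  offset-columnSum : ∀ k i → i ≤ 2 * a → ∑ℕ (suc (2 * suc k)) (λ j → offset j i) ≡ suc (2 * suc k) * a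
  offset-columnSum k i le = begin
    ∑ℕ (suc (2 * suc k)) (λ j → offset j i)
      ≡⟨ cong (λ r → ∑ℕ (suc r) (λ j → offset j i)) (*-suc 2 k) ⟩
    i + (offset 1 i + (offset 2 i + ∑ℕ (2 * k) (λ j → pairedRow j i)))
      ≡⟨ regroup i (offset 1 i) (offset 2 i) _ ⟩
    (i + (offset 1 i + offset 2 i)) + ∑ℕ (2 * k) (λ j → pairedRow j i)
      ≡⟨ cong₂ _+_ (firstRows-sum i le) (pairedRows-sum k i le) ⟩
    3 * a + k * (2 * a)
      ≡⟨ collect k a ⟩
    suc (2 * suc k) * a   ∎
    where
    open ≡-Reasoning
    regroup : ∀ w x y z → w + (x + (y + z)) ≡ (w + (x + y)) + z
    regroup = solve-∀
    collect : ∀ k a → 3 * a + k * (2 * a) ≡ suc (2 * suc k) * a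
    collect = solve-∀

-- Labels of clique edges: the pair x < y gets colex x y = tri y + x, which
-- enumerates the pairs with y < n bijectively onto 0 … tri n − 1.
colex : ℕ → ℕ → ℕ
colex x y = tri y + x

tri-mono : ∀ {y y'} → y ≤ y' → tri y ≤ tri y'
tri-mono {zero} _ = z≤n
tri-mono {suc y} {suc y'} (s≤s le) = +-mono-≤ (tri-mono le) le

colex-< : ∀ {x y} → x < y → colex x y < tri (suc y)
colex-< {x} {y} lt = +-monoʳ-< (tri y) lt

colex-injective : ∀ {x y x' y'} → x < y → x' < y' → colex x y ≡ colex x' y' → x ≡ x' × y ≡ y'
colex-injective {x} {y} {x'} {y'} lt lt' eq with <-cmp y y'
... | tri< y<y' _ _ = ⊥-elim (<-irrefl eq (<-≤-trans (colex-< lt) (≤-trans (tri-mono y<y') (m≤m+n (tri y') x'))))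
... | tri> _ _ y>y' = ⊥-elim (<-irrefl (sym eq) (<-≤-trans (colex-< lt') (≤-trans (tri-mono y>y') (m≤m+n (tri y) x))))
... | tri≈ _ refl _ = +-cancelˡ-≡ (tri y) x x' eq , refl

tri-odd : ∀ b → tri (suc (2 * b)) ≡ suc (2 * b) * b
tri-odd zero = refl
tri-odd (suc b) = begin
  tri (suc (2 * suc b))                                  ≡⟨ cong (λ x → tri (suc x)) (*-suc 2 b) ⟩
  tri (suc (2 * b)) + suc (2 * b) + suc (suc (2 * b))    ≡⟨ cong (λ x → x + suc (2 * b) + suc (suc (2 * b))) (tri-odd b) ⟩
  suc (2 * b) * b + suc (2 * b) + suc (suc (2 * b))      ≡⟨ identity b ⟩
  suc (2 * suc b) * suc b                                ∎
  where
  open ≡-Reasoning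
  identity : ∀ b → suc (2 * b) * b + suc (2 * b) + suc (suc (2 * b)) ≡ suc (2 * suc b) * suc b
  identity = solve-∀

module WeightLabeling (G : Graph) (L : Fin (V G) × Fin (V G) → ℕ)
    (L-< : ∀ {p} → p ∈ edges G → L p < numE G) where

  labeling : Labeling G
  labeling e = fromℕ< (L-< (∈-lookup {xs = edges G} e))

  toℕ-labeling : ∀ e → toℕ (labeling e) ≡ L (ends G e)
  toℕ-labeling e = FP.toℕ-fromℕ< _

  labeling-bijective : Unique (edges G) →
    (∀ {p q} → p ∈ edges G → q ∈ edges G → L p ≡ L q → p ≡ q) → Bijective _≡_ _≡_ labeling
  labeling-bijective unique separates = injective , surjective
    where
    injective : ∀ {e e'} → labeling e ≡ labeling e' → e ≡ e'
    injective {e} {e'} eq = lookup-injective (edges G) unique e e'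
      (separates (∈-lookup {xs = edges G} e) (∈-lookup {xs = edges G} e')
        (trans (sym (toℕ-labeling e)) (trans (cong toℕ eq) (toℕ-labeling e'))))
    surjective : ∀ y → ∃ λ x → ∀ {z} → z ≡ x → labeling z ≡ y
    surjective y with injective⇒surjective labeling injective y
    ... | x , hit = x , λ { refl → hit }

  incidentWeight : Fin (V G) → Fin (V G) × Fin (V G) → ℕ
  incidentWeight u p = if (does (proj₁ p F.≟ u) ∨ does (proj₂ p F.≟ u)) then suc (L p) else 0

  fplus-labeling : ∀ u → fplus G labeling u ≡ sumOver (edges G) (incidentWeight u)
  fplus-labeling u = begin
    fplus G labeling u
      ≡⟨ sumOver-allFin (numE G) _ ⟩
    ∑ (λ e → if incident G u e then label G labeling e else 0)
      ≡⟨ sum-cong-≗ {numE G} (λ e → cong₂ (λ b w → if b then suc w else 0)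
           (cong₂ _∨_ (isYes≗does (proj₁ (ends G e) F.≟ u)) (isYes≗does (proj₂ (ends G e) F.≟ u)))
           (toℕ-labeling e)) ⟩
    ∑ (λ e → incidentWeight u (ends G e))
      ≡⟨ ∑-lookup (edges G) (incidentWeight u) ⟩
    sumOver (edges G) (incidentWeight u)   ∎
    where open ≡-Reasoning

module JoinEdges (m n : ℕ) where

  G : Graph
  G = C∨K m n

  cycleList : List (Fin m × Fin m)
  cycleList = map (λ i → i , next i) (allFin m)

  cliqueRow : Fin n → List (Fin n × Fin n)
  cliqueRow x = map (λ y → x , y) (filter (λ y → x F.<? y) (allFin n))

  cliqueList : List (Fin n × Fin n)
  cliqueList = concatMap cliqueRow (allFin n)

  joinList : List (Fin m × Fin n)
  joinList = cartesianProduct (allFin m) (allFin n)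

  onCycle : Fin m × Fin m → Fin (m + n) × Fin (m + n)
  onCycle p = (proj₁ p ↑ˡ n) , (proj₂ p ↑ˡ n)

  onClique : Fin n × Fin n → Fin (m + n) × Fin (m + n)
  onClique p = (m ↑ʳ proj₁ p) , (m ↑ʳ proj₂ p)

  onJoin : Fin m × Fin n → Fin (m + n) × Fin (m + n)
  onJoin p = (proj₁ p ↑ˡ n) , (m ↑ʳ proj₂ p)

  ↑ˡ≢↑ʳ : ∀ (i : Fin m) (j : Fin n) → i ↑ˡ n ≢ m ↑ʳ j
  ↑ˡ≢↑ʳ i j eq = <-irrefl (trans (sym (FP.toℕ-↑ˡ i n)) (trans (cong toℕ eq) (FP.toℕ-↑ʳ m j)))
    (<-≤-trans (FP.toℕ<n i) (m≤m+n m (toℕ j)))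

  vertexKind : ∀ u → (∃ λ i → u ≡ i ↑ˡ n) ⊎ (∃ λ j → u ≡ m ↑ʳ j)
  vertexKind u with F.splitAt m {n} u in eq
  ... | inj₁ i = inj₁ (i , sym (FP.splitAt⁻¹-↑ˡ eq))
  ... | inj₂ j = inj₂ (j , sym (FP.splitAt⁻¹-↑ʳ eq))

  ↑ˡ-≟ : ∀ (k i : Fin m) → does (k ↑ˡ n F.≟ i ↑ˡ n) ≡ does (k F.≟ i)
  ↑ˡ-≟ k i = does-⇔ (FP.↑ˡ-injective n k i) (cong (_↑ˡ n)) (k ↑ˡ n F.≟ i ↑ˡ n) (k F.≟ i)

  ↑ʳ-≟ : ∀ (x j : Fin n) → does (m ↑ʳ x F.≟ m ↑ʳ j) ≡ does (x F.≟ j)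
  ↑ʳ-≟ x j = does-⇔ (FP.↑ʳ-injective m x j) (cong (m ↑ʳ_)) (m ↑ʳ x F.≟ m ↑ʳ j) (x F.≟ j)

  ↑ˡ-≟-↑ʳ : ∀ (i : Fin m) (x : Fin n) → does (i ↑ˡ n F.≟ m ↑ʳ x) ≡ false
  ↑ˡ-≟-↑ʳ i x = does-no (↑ˡ≢↑ʳ i x) (i ↑ˡ n F.≟ m ↑ʳ x)

  ↑ʳ-≟-↑ˡ : ∀ (x : Fin n) (i : Fin m) → does (m ↑ʳ x F.≟ i ↑ˡ n) ≡ false
  ↑ʳ-≟-↑ˡ x i = does-no (λ e → ↑ˡ≢↑ʳ i x (sym e)) (m ↑ʳ x F.≟ i ↑ˡ n)

  data EdgeKind : Fin (m + n) × Fin (m + n) → Set where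
    cycleEdge  : (k : Fin m) → EdgeKind (k ↑ˡ n , next k ↑ˡ n)
    cliqueEdge : (x y : Fin n) → toℕ x < toℕ y → EdgeKind (m ↑ʳ x , m ↑ʳ y)
    joinEdge   : (i : Fin m) (j : Fin n) → EdgeKind (i ↑ˡ n , m ↑ʳ j)

  edgeKind : ∀ {p} → p ∈ edges G → EdgeKind p
  edgeKind p∈ with ∈-++⁻ (map onCycle cycleList) p∈
  ... | inj₁ p∈cycle with ∈-map⁻ onCycle p∈cycle
  ...   | q , q∈ , refl with ∈-map⁻ (λ i → i , next i) q∈
  ...     | k , _ , refl = cycleEdge k
  edgeKind p∈ | inj₂ p∈rest with ∈-++⁻ (map onClique cliqueList) p∈rest
  ... | inj₁ p∈clique with ∈-map⁻ onClique p∈clique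
  ...   | q , q∈ , refl with Any.satisfied (∈-concatMap⁻ cliqueRow {xs = allFin n} q∈)
  ...     | x , q∈row with ∈-map⁻ (λ y → x , y) q∈row
  ...       | y , y∈ , refl = cliqueEdge x y (proj₂ (∈-filter⁻ (λ y → x F.<? y) {xs = allFin n} y∈))
  edgeKind p∈ | inj₂ p∈rest | inj₂ p∈join with ∈-map⁻ onJoin p∈join
  ... | (i , j) , _ , refl = joinEdge i j

  edges-unique : Unique (edges G)
  edges-unique = UniqueP.++⁺ cycleUnique (UniqueP.++⁺ cliqueUnique joinUnique clique#join) cycle#rest
    where
    cycleUnique : Unique (map onCycle cycleList)
    cycleUnique = UniqueP.map⁺
      (λ eq → cong₂ _,_ (FP.↑ˡ-injective n _ _ (cong proj₁ eq)) (FP.↑ˡ-injective n _ _ (cong proj₂ eq)))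
      (UniqueP.map⁺ (cong proj₁) (UniqueP.allFin⁺ m))
    rows-disjoint : ∀ {x x'} → x ≢ x' → Disjoint (cliqueRow x) (cliqueRow x')
    rows-disjoint {x} {x'} x≢x' (p , q) with ∈-map⁻ (λ y → x , y) p | ∈-map⁻ (λ y → x' , y) q
    ... | _ , _ , e | _ , _ , e' = x≢x' (cong proj₁ (trans (sym e) e'))
    cliqueUnique : Unique (map onClique cliqueList)
    cliqueUnique = UniqueP.map⁺
      (λ eq → cong₂ _,_ (FP.↑ʳ-injective m _ _ (cong proj₁ eq)) (FP.↑ʳ-injective m _ _ (cong proj₂ eq)))
      (UniqueP.concat⁺
        (AllP.map⁺ (AllP.tabulate⁺ {f = λ x → x} (λ x →
          UniqueP.map⁺ (cong proj₂) (UniqueP.filter⁺ (λ y → x F.<? y) (UniqueP.allFin⁺ n)))))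
        (AllPairsP.map⁺ (AllPairsP.tabulate⁺ {f = λ x → x} rows-disjoint)))
    joinUnique : Unique (map onJoin joinList)
    joinUnique = UniqueP.map⁺
      (λ eq → cong₂ _,_ (FP.↑ˡ-injective n _ _ (cong proj₁ eq)) (FP.↑ʳ-injective m _ _ (cong proj₂ eq)))
      (UniqueP.cartesianProduct⁺ (UniqueP.allFin⁺ m) (UniqueP.allFin⁺ n))
    clique#join : Disjoint (map onClique cliqueList) (map onJoin joinList)
    clique#join (p , q) with ∈-map⁻ onClique p | ∈-map⁻ onJoin q
    ... | (x , _) , _ , e | (i , _) , _ , e' = ↑ˡ≢↑ʳ i x (cong proj₁ (trans (sym e') e))
    cycle#rest : Disjoint (map onCycle cycleList) (map onClique cliqueList ++ map onJoin joinList)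
    cycle#rest (p , q) with ∈-map⁻ onCycle p | ∈-++⁻ (map onClique cliqueList) q
    ... | (k , _) , _ , e | inj₁ q∈ with ∈-map⁻ onClique q∈
    ...   | (x , _) , _ , e' = ↑ˡ≢↑ʳ k x (cong proj₁ (trans (sym e) e'))
    cycle#rest (p , q) | (_ , k') , _ , e | inj₂ q∈ with ∈-map⁻ onJoin q∈
    ...   | (_ , j) , _ , e' = ↑ˡ≢↑ʳ k' j (cong proj₂ (trans (sym e) e'))

  sumOver-edges : ∀ g → sumOver (edges G) g ≡
      ∑[ k < m ] g (k ↑ˡ n , next k ↑ˡ n)
    + (∑[ x < n ] ∑[ y < n ] (if does (x F.<? y) then g (m ↑ʳ x , m ↑ʳ y) else 0)
    +  ∑[ i < m ] ∑[ j < n ] g (i ↑ˡ n , m ↑ʳ j))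
  sumOver-edges g = begin
    sumOver (edges G) g
      ≡⟨ sumOver-++ (map onCycle cycleList) _ g ⟩
    sumOver (map onCycle cycleList) g + sumOver (map onClique cliqueList ++ map onJoin joinList) g
      ≡⟨ cong (sumOver (map onCycle cycleList) g +_) (sumOver-++ (map onClique cliqueList) _ g) ⟩
    sumOver (map onCycle cycleList) g + (sumOver (map onClique cliqueList) g + sumOver (map onJoin joinList) g)
      ≡⟨ cong₂ _+_ cycleBlock (cong₂ _+_ cliqueBlock joinBlock) ⟩
    _ ∎
    where
    open ≡-Reasoning
    cycleBlock : sumOver (map onCycle cycleList) g ≡ ∑[ k < m ] g (k ↑ˡ n , next k ↑ˡ n)
    cycleBlock = trans (sumOver-map onCycle cycleList g)
      (trans (sumOver-map (λ i → i , next i) (allFin m) _) (sumOver-allFin m _))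
    cliqueBlock : sumOver (map onClique cliqueList) g ≡
      ∑[ x < n ] ∑[ y < n ] (if does (x F.<? y) then g (m ↑ʳ x , m ↑ʳ y) else 0)
    cliqueBlock = trans (sumOver-map onClique cliqueList g)
      (trans (sumOver-concatMap cliqueRow (allFin n) _) (trans (sumOver-allFin n _) (sum-cong-≗ {n} λ x →
        trans (sumOver-map (λ y → x , y) (filter (λ y → x F.<? y) (allFin n)) _)
          (trans (sumOver-filter (λ y → x F.<? y) (allFin n) _) (sumOver-allFin n _)))))
    joinBlock : sumOver (map onJoin joinList) g ≡ ∑[ i < m ] ∑[ j < n ] g (i ↑ˡ n , m ↑ʳ j)
    joinBlock = trans (sumOver-map onJoin joinList g)
      (trans (sumOver-cartesianProduct (allFin m) (allFin n) _)
        (trans (sumOver-allFin m _) (sum-cong-≗ {m} (λ i → sumOver-allFin n _))))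

  numE-C∨K : numE G ≡ m + (tri n + m * n)
  numE-C∨K = begin
    numE G                                 ≡⟨ length≡sumOver-1 (edges G) ⟩
    sumOver (edges G) (λ _ → 1)            ≡⟨ sumOver-edges (λ _ → 1) ⟩
    ∑[ k < m ] 1 + (cliquePairs + ∑[ i < m ] ∑[ j < n ] 1)
      ≡⟨ cong₂ _+_ (ones m) (cong₂ _+_ pairs (trans (sum-cong-≗ {m} (λ _ → ones n)) (∑-const m n))) ⟩
    m + (tri n + m * n)                    ∎
    where
    open ≡-Reasoning
    ones : ∀ p → ∑[ k < p ] 1 ≡ p
    ones p = trans (∑-const p 1) (*-identityʳ p)
    cliquePairs : ℕ
    cliquePairs = ∑[ x < n ] ∑[ y < n ] (if does (x F.<? y) then 1 else 0)
    pairs : cliquePairs ≡ tri n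
    pairs = begin
      cliquePairs                                            ≡⟨ ∑-comm {n} {n} (λ x y → if does (x F.<? y) then 1 else 0) ⟩
      ∑[ y < n ] ∑[ x < n ] (if does (x F.<? y) then 1 else 0)
        ≡⟨ sum-cong-≗ {n} (λ y → ∑-below (toℕ y) (<⇒≤ (FP.toℕ<n y))) ⟩
      ∑ℕ n (λ y → y)                                         ≡⟨ ∑ℕ-id n ⟩
      tri n                                                  ∎

-- Labels (counted from 0) fill three consecutive blocks: the
-- cycle edges take 0 … m − 1 via cycleLabel, the join edge (i, j) takes
-- m + j m + offset j i, and the clique edges take B + colex from B = m + m n on.
module Construction (a k : ℕ) (a≥1 : 1 ≤ a) where

  open CycleLabels a
  open JoinOffsets a

  b m n : ℕ
  b = suc k
  m = suc (2 * a)
  n = suc (2 * b)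

  open JoinEdges m n

  B : ℕ
  B = m + m * n

  joinLabel : ℕ → ℕ → ℕ
  joinLabel i j = m + j * m + offset j i

  cliqueLabel : ℕ → ℕ → ℕ
  cliqueLabel x y = B + colex x y

  sideLabel : Fin m ⊎ Fin n → Fin m ⊎ Fin n → ℕ
  sideLabel (inj₁ i) (inj₁ _) = cycleLabel (toℕ i)
  sideLabel (inj₁ i) (inj₂ j) = joinLabel (toℕ i) (toℕ j)
  sideLabel (inj₂ x) (inj₂ y) = cliqueLabel (toℕ x) (toℕ y)
  sideLabel (inj₂ _) (inj₁ _) = 0

  L : Fin (m + n) × Fin (m + n) → ℕ
  L p = sideLabel (splitAt m (proj₁ p)) (splitAt m (proj₂ p))

  L-cycle : ∀ (i k : Fin m) → L (i ↑ˡ n , k ↑ˡ n) ≡ cycleLabel (toℕ i)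
  L-cycle i k = cong₂ sideLabel (FP.splitAt-↑ˡ m i n) (FP.splitAt-↑ˡ m k n)

  L-join : ∀ (i : Fin m) (j : Fin n) → L (i ↑ˡ n , m ↑ʳ j) ≡ joinLabel (toℕ i) (toℕ j)
  L-join i j = cong₂ sideLabel (FP.splitAt-↑ˡ m i n) (FP.splitAt-↑ʳ m n j)

  L-clique : ∀ (x y : Fin n) → L (m ↑ʳ x , m ↑ʳ y) ≡ cliqueLabel (toℕ x) (toℕ y)
  L-clique x y = cong₂ sideLabel (FP.splitAt-↑ʳ m n x) (FP.splitAt-↑ʳ m n y)

  i≤2a : ∀ (i : Fin m) → toℕ i ≤ 2 * a
  i≤2a i = ℕ.s≤s⁻¹ (FP.toℕ<n i)

  cycleLabel<m : ∀ (k : Fin m) → cycleLabel (toℕ k) < m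
  cycleLabel<m k = s≤s (cycleLabel-≤ (toℕ k) (i≤2a k))

  offset<m : ∀ j (i : Fin m) → offset j (toℕ i) < m
  offset<m j i = s≤s (offset-≤ j (toℕ i) (i≤2a i))

  m≤joinLabel : ∀ i j → m ≤ joinLabel i j
  m≤joinLabel i j = ≤-trans (m≤m+n m _) (m≤m+n _ _)

  joinLabel<B : ∀ (i : Fin m) (j : Fin n) → joinLabel (toℕ i) (toℕ j) < B
  joinLabel<B i j = subst (_< B) (sym (+-assoc m _ _)) (+-monoʳ-< m (begin-strict
    toℕ j * m + offset (toℕ j) (toℕ i)   <⟨ +-monoʳ-< (toℕ j * m) (offset<m (toℕ j) i) ⟩
    toℕ j * m + m                        ≡⟨ +-comm (toℕ j * m) m ⟩
    suc (toℕ j) * m                      ≤⟨ *-monoˡ-≤ m (FP.toℕ<n j) ⟩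
    n * m                                ≡⟨ *-comm n m ⟩
    m * n                                ∎))
    where open ≤-Reasoning

  L-< : ∀ {p} → p ∈ edges G → L p < numE G
  L-< {p} p∈ = subst (L p <_) (sym numE-C∨K) (bound (edgeKind p∈))
    where
    bound : ∀ {p} → EdgeKind p → L p < m + (tri n + m * n)
    bound (cycleEdge k) = subst (_< _) (sym (L-cycle k (next k))) (≤-trans (cycleLabel<m k) (m≤m+n m _))
    bound (joinEdge i j) = subst (_< _) (sym (L-join i j)) (<-≤-trans (joinLabel<B i j)
      (+-monoʳ-≤ m (m≤n+m (m * n) (tri n))))
    bound (cliqueEdge x y lt) = subst (_< _) (sym (L-clique x y)) (begin-strict
      B + colex (toℕ x) (toℕ y)   <⟨ +-monoʳ-< B (<-≤-trans (colex-< lt) (tri-mono (FP.toℕ<n y))) ⟩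
      B + tri n                   ≡⟨ +-assoc m (m * n) (tri n) ⟩
      m + (m * n + tri n)         ≡⟨ cong (m +_) (+-comm (m * n) (tri n)) ⟩
      m + (tri n + m * n)         ∎)
      where open ≤-Reasoning

  cycle<joinLabel : ∀ (k : Fin m) i j → L (k ↑ˡ n , next k ↑ˡ n) < L (i ↑ˡ n , m ↑ʳ j)
  cycle<joinLabel k i j = subst₂ _<_ (sym (L-cycle k (next k))) (sym (L-join i j))
    (<-≤-trans (cycleLabel<m k) (m≤joinLabel (toℕ i) (toℕ j)))

  cycle<cliqueLabel : ∀ (k : Fin m) x y → L (k ↑ˡ n , next k ↑ˡ n) < L (m ↑ʳ x , m ↑ʳ y)
  cycle<cliqueLabel k x y = subst₂ _<_ (sym (L-cycle k (next k))) (sym (L-clique x y))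
    (<-≤-trans (cycleLabel<m k) (≤-trans (m≤m+n m _) (m≤m+n B _)))

  join<cliqueLabel : ∀ i j x y → L (i ↑ˡ n , m ↑ʳ j) < L (m ↑ʳ x , m ↑ʳ y)
  join<cliqueLabel i j x y = subst₂ _<_ (sym (L-join i j)) (sym (L-clique x y))
    (<-≤-trans (joinLabel<B i j) (m≤m+n B _))

  -- L separates the edges: the three blocks are disjoint, and injective
  L-separates : ∀ {p q} → EdgeKind p → EdgeKind q → L p ≡ L q → p ≡ q
  L-separates (cycleEdge k) (cycleEdge k') eq
    with FP.toℕ-injective {i = k} {j = k'} (cycleLabel-injective (i≤2a k) (i≤2a k')
           (trans (sym (L-cycle k (next k))) (trans eq (L-cycle k' (next k')))))
  ... | refl = refl
  L-separates (cycleEdge k) (joinEdge i j) eq = ⊥-elim (<-irrefl eq (cycle<joinLabel k i j))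
  L-separates (joinEdge i j) (cycleEdge k) eq = ⊥-elim (<-irrefl (sym eq) (cycle<joinLabel k i j))
  L-separates (cycleEdge k) (cliqueEdge x y _) eq = ⊥-elim (<-irrefl eq (cycle<cliqueLabel k x y))
  L-separates (cliqueEdge x y _) (cycleEdge k) eq = ⊥-elim (<-irrefl (sym eq) (cycle<cliqueLabel k x y))
  L-separates (joinEdge i j) (cliqueEdge x y _) eq = ⊥-elim (<-irrefl eq (join<cliqueLabel i j x y))
  L-separates (cliqueEdge x y _) (joinEdge i j) eq = ⊥-elim (<-irrefl (sym eq) (join<cliqueLabel i j x y))
  L-separates (cliqueEdge x y lt) (cliqueEdge x' y' lt') eq
    with colex-injective lt lt' (+-cancelˡ-≡ B _ _ (trans (sym (L-clique x y)) (trans eq (L-clique x' y'))))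
  ... | ex , ey with FP.toℕ-injective {i = x} {j = x'} ex | FP.toℕ-injective {i = y} {j = y'} ey
  ...   | refl | refl = refl
  L-separates (joinEdge i j) (joinEdge i' j') eq with FP.toℕ-injective {i = j} {j = j'} sameRow
    where
    rest : toℕ j * m + offset (toℕ j) (toℕ i) ≡ toℕ j' * m + offset (toℕ j') (toℕ i')
    rest = +-cancelˡ-≡ m _ _ (trans (sym (+-assoc m _ _))
      (trans (trans (sym (L-join i j)) (trans eq (L-join i' j'))) (+-assoc m _ _)))
    sameRow : toℕ j ≡ toℕ j'
    sameRow = quotient-unique m _ _ _ _ (offset<m (toℕ j) i) (offset<m (toℕ j') i') rest
  ... | refl with FP.toℕ-injective {i = i} {j = i'} (offset-injective (toℕ j) (i≤2a i) (i≤2a i')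
                    (+-cancelˡ-≡ (m + toℕ j * m) _ _ (trans (sym (L-join i j)) (trans eq (L-join i' j)))))
  ...   | refl = refl

  open WeightLabeling G L L-< using (labeling; labeling-bijective; incidentWeight; fplus-labeling)

  f : Labeling G
  f = labeling

  f-bijective : Bijective _≡_ _≡_ f
  f-bijective = labeling-bijective edges-unique (λ p∈ q∈ → L-separates (edgeKind p∈) (edgeKind q∈))

  W : Fin (m + n) → Fin (m + n) × Fin (m + n) → ℕ
  W = incidentWeight

  W-cong : ∀ u p {c d w} → does (proj₁ p F.≟ u) ≡ c → does (proj₂ p F.≟ u) ≡ d → L p ≡ w →
    W u p ≡ (if c ∨ d then suc w else 0)
  W-cong u p {c} {d} e₁ e₂ e₃ = trans (cong₂ (λ c d → if c ∨ d then suc (L p) else 0) e₁ e₂)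
                                      (cong (λ w → if c ∨ d then suc w else 0) e₃)

  -- the join edges at any cycle vertex carry the same total R
  R : ℕ
  R = n * suc m + n * b * m + n * a

  joinRow-sum : ∀ (i : Fin m) → ∑[ j < n ] suc (joinLabel (toℕ i) (toℕ j)) ≡ R
  joinRow-sum i = begin
    ∑ℕ n (λ j → (suc m + j * m) + offset j (toℕ i))
      ≡⟨ ∑ℕ-+ n (λ j → suc m + j * m) (λ j → offset j (toℕ i)) ⟩
    ∑ℕ n (λ j → suc m + j * m) + ∑ℕ n (λ j → offset j (toℕ i))
      ≡⟨ cong (_+ ∑ℕ n (λ j → offset j (toℕ i))) (∑ℕ-+ n (λ _ → suc m) (λ j → j * m)) ⟩
    ∑ℕ n (λ _ → suc m) + ∑ℕ n (λ j → j * m) + ∑ℕ n (λ j → offset j (toℕ i))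
      ≡⟨ cong₂ _+_ (cong₂ _+_ (∑-const n (suc m)) columnIndices) (offset-columnSum k (toℕ i) (i≤2a i)) ⟩
    n * suc m + n * b * m + n * a   ∎
    where
    open ≡-Reasoning
    columnIndices : ∑ℕ n (λ j → j * m) ≡ n * b * m
    columnIndices = trans (∑ℕ-*ʳ n (λ j → j) m) (cong (_* m) (trans (∑ℕ-id n) (tri-odd b)))

  cycleBlock-at-cycle : ∀ (i : Fin m) → ∑[ k < m ] W (i ↑ˡ n) (k ↑ˡ n , next k ↑ˡ n) ≡
    suc (cycleLabel (toℕ i)) + suc (cycleLabel (prevℕ (2 * a) (toℕ i)))
  cycleBlock-at-cycle i = begin
    ∑[ k < m ] W (i ↑ˡ n) (k ↑ˡ n , next k ↑ˡ n)
      ≡⟨ sum-cong-≗ {m} (λ k → trans (W-cong (i ↑ˡ n) (k ↑ˡ n , next k ↑ˡ n) (↑ˡ-≟ k i) (↑ˡ-≟ (next k) i)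
                                               (L-cycle k (next k)))
                                    (split k)) ⟩
    ∑[ k < m ] (at i k + at (previous i) k)
      ≡⟨ ∑-distrib-+ {m} (at i) (at (previous i)) ⟩
    ∑[ k < m ] at i k + ∑[ k < m ] at (previous i) k
      ≡⟨ cong₂ _+_ (∑-pick i g) (∑-pick (previous i) g) ⟩
    g i + g (previous i)
      ≡⟨ cong (λ t → g i + suc (cycleLabel t)) (toℕ-previous i) ⟩
    suc (cycleLabel (toℕ i)) + suc (cycleLabel (prevℕ (2 * a) (toℕ i)))   ∎
    where
    open ≡-Reasoning
    g : Fin m → ℕ
    g k = suc (cycleLabel (toℕ k))
    at : Fin m → Fin m → ℕ
    at v k = if does (k F.≟ v) then g k else 0
    -- the edge k → next k meets i either at its start or at its end, not both
    split : ∀ k → (if does (k F.≟ i) ∨ does (next k F.≟ i) then g k else 0) ≡ at i k + at (previous i) k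
    split k with k F.≟ i | k F.≟ previous i | next k F.≟ i
    ... | yes refl | yes e | _ = ⊥-elim (previous≢ (≤-trans a≥1 (m≤m+n a _)) k (sym e))
    ... | yes _ | no _ | _ = sym (+-identityʳ _)
    ... | no _ | yes _ | yes _ = refl
    ... | no _ | yes e | no next≢ = ⊥-elim (next≢ (trans (cong next e) (next-previous i)))
    ... | no _ | no ≢previous | yes e = ⊥-elim (≢previous (next≡⇒≡previous e))
    ... | no _ | no _ | no _ = refl

  cliqueBlock-at-cycle : ∀ (i : Fin m) →
    ∑[ x < n ] ∑[ y < n ] (if does (x F.<? y) then W (i ↑ˡ n) (m ↑ʳ x , m ↑ʳ y) else 0) ≡ 0
  cliqueBlock-at-cycle i = trans (sum-cong-≗ {n} (λ x → trans (sum-cong-≗ {n} (λ y →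
      trans (cong (λ w → if does (x F.<? y) then w else 0)
                  (W-cong (i ↑ˡ n) (m ↑ʳ x , m ↑ʳ y) (↑ʳ-≟-↑ˡ x i) (↑ʳ-≟-↑ˡ y i) refl))
            (if-eta (does (x F.<? y)))))
    (∑-zero n))) (∑-zero n)

  joinBlock-at-cycle : ∀ (i : Fin m) → ∑[ k < m ] ∑[ j < n ] W (i ↑ˡ n) (k ↑ˡ n , m ↑ʳ j) ≡ R
  joinBlock-at-cycle i = begin
    ∑[ k < m ] ∑[ j < n ] W (i ↑ˡ n) (k ↑ˡ n , m ↑ʳ j)
      ≡⟨ sum-cong-≗ {m} (λ k → trans (sum-cong-≗ {n} (λ j →
           trans (W-cong (i ↑ˡ n) (k ↑ˡ n , m ↑ʳ j) (↑ˡ-≟ k i) (↑ʳ-≟-↑ˡ j i) (L-join k j))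
                 (cong (λ c → if c then suc (joinLabel (toℕ k) (toℕ j)) else 0) (∨-identityʳ (does (k F.≟ i))))))
         (∑-if {n} (does (k F.≟ i)) (λ j → suc (joinLabel (toℕ k) (toℕ j))))) ⟩
    ∑[ k < m ] (if does (k F.≟ i) then ∑[ j < n ] suc (joinLabel (toℕ k) (toℕ j)) else 0)
      ≡⟨ ∑-pick i (λ k → ∑[ j < n ] suc (joinLabel (toℕ k) (toℕ j))) ⟩
    ∑[ j < n ] suc (joinLabel (toℕ i) (toℕ j))
      ≡⟨ joinRow-sum i ⟩
    R   ∎
    where open ≡-Reasoning

  cycleVertexSum : ∀ (i : Fin m) → fplus G f (i ↑ˡ n) ≡ 2 + cycleColour (toℕ i) + R
  cycleVertexSum i = begin
    fplus G f (i ↑ˡ n)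
      ≡⟨ trans (fplus-labeling (i ↑ˡ n)) (sumOver-edges (W (i ↑ˡ n))) ⟩
    _ ≡⟨ cong₂ _+_ (cycleBlock-at-cycle i) (cong₂ _+_ (cliqueBlock-at-cycle i) (joinBlock-at-cycle i)) ⟩
    suc (cycleLabel (toℕ i)) + suc (cycleLabel (prevℕ (2 * a) (toℕ i))) + R
      ≡⟨ cong (λ s → suc s + R) (trans (+-suc _ _) (cong suc (cycleLabel-sum (toℕ i) (i≤2a i)))) ⟩
    2 + cycleColour (toℕ i) + R   ∎
    where open ≡-Reasoning

  cliqueWeight : ℕ → ℕ → ℕ
  cliqueWeight x t = (if does (t ℕ.<? x) then suc (cliqueLabel t x) else 0)
                   + (if does (x ℕ.<? t) then suc (cliqueLabel x t) else 0)

  cliqueSum joinColumn cliqueVertexValue : ℕ → ℕ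
  cliqueSum t = ∑[ x < n ] cliqueWeight (toℕ x) t
  joinColumn t = ∑[ k < m ] suc (joinLabel (toℕ k) t)
  cliqueVertexValue t = cliqueSum t + joinColumn t

  cycleBlock-at-clique : ∀ (j : Fin n) → ∑[ k < m ] W (m ↑ʳ j) (k ↑ˡ n , next k ↑ˡ n) ≡ 0
  cycleBlock-at-clique j = trans (sum-cong-≗ {m} (λ k →
    W-cong (m ↑ʳ j) (k ↑ˡ n , next k ↑ˡ n) (↑ˡ-≟-↑ʳ k j) (↑ˡ-≟-↑ʳ (next k) j) refl)) (∑-zero m)

  cliqueBlock-at-clique : ∀ (j : Fin n) →
    ∑[ x < n ] ∑[ y < n ] (if does (x F.<? y) then W (m ↑ʳ j) (m ↑ʳ x , m ↑ʳ y) else 0) ≡ cliqueSum (toℕ j)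
  cliqueBlock-at-clique j = begin
    ∑[ x < n ] ∑[ y < n ] (if does (x F.<? y) then W (m ↑ʳ j) (m ↑ʳ x , m ↑ʳ y) else 0)
      ≡⟨ sum-cong-≗ {n} (λ x → trans (sum-cong-≗ {n} (λ y → cong (λ w → if does (x F.<? y) then w else 0)
           (W-cong (m ↑ʳ j) (m ↑ʳ x , m ↑ʳ y) (↑ʳ-≟ x j) (↑ʳ-≟ y j) (L-clique x y)))) (row x)) ⟩
    ∑[ x < n ] ((if does (x F.≟ j) then above else 0) + (if does (x F.<? j) then w x j else 0))
      ≡⟨ ∑-distrib-+ {n} (λ x → if does (x F.≟ j) then above else 0) below ⟩
    ∑[ x < n ] (if does (x F.≟ j) then above else 0) + ∑[ x < n ] (if does (x F.<? j) then w x j else 0)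
      ≡⟨ cong (_+ ∑[ x < n ] (if does (x F.<? j) then w x j else 0)) (∑-pick j (λ _ → above)) ⟩
    above + ∑[ x < n ] (if does (x F.<? j) then w x j else 0)
      ≡⟨ sym (∑-distrib-+ {n} (λ x → if does (j F.<? x) then w j x else 0) below) ⟩
    cliqueSum (toℕ j)   ∎
    where
    open ≡-Reasoning
    w : Fin n → Fin n → ℕ
    w x y = suc (cliqueLabel (toℕ x) (toℕ y))
    above : ℕ
    above = ∑[ y < n ] (if does (j F.<? y) then w j y else 0)
    below : Fin n → ℕ
    below x = if does (x F.<? j) then w x j else 0
    row : ∀ x → ∑[ y < n ] (if does (x F.<? y) then (if does (x F.≟ j) ∨ does (y F.≟ j) then w x y else 0) else 0)
              ≡ (if does (x F.≟ j) then above else 0) + (if does (x F.<? j) then w x j else 0)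
    row x with x F.≟ j
    ... | yes refl = trans (sym (+-identityʳ above))
                           (cong (λ c → above + (if c then w x x else 0)) (sym (does-no (<-irrefl refl) (x F.<? x))))
    ... | no _ = trans (sum-cong-≗ {n} (λ y → if-swap-then (does (x F.<? y)) (does (y F.≟ j)) {w x y} {0}))
                       (∑-pick j (λ y → if does (x F.<? y) then w x y else 0))

  joinBlock-at-clique : ∀ (j : Fin n) → ∑[ k < m ] ∑[ y < n ] W (m ↑ʳ j) (k ↑ˡ n , m ↑ʳ y) ≡ joinColumn (toℕ j)
  joinBlock-at-clique j = sum-cong-≗ {m} (λ k →
    trans (sum-cong-≗ {n} (λ y → W-cong (m ↑ʳ j) (k ↑ˡ n , m ↑ʳ y) (↑ˡ-≟-↑ʳ k j) (↑ʳ-≟ y j) (L-join k y)))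
          (∑-pick j (λ y → suc (joinLabel (toℕ k) (toℕ y)))))

  cliqueVertexSum : ∀ (j : Fin n) → fplus G f (m ↑ʳ j) ≡ cliqueVertexValue (toℕ j)
  cliqueVertexSum j = begin
    fplus G f (m ↑ʳ j)
      ≡⟨ trans (fplus-labeling (m ↑ʳ j)) (sumOver-edges (W (m ↑ʳ j))) ⟩
    _ ≡⟨ cong₂ _+_ (cycleBlock-at-clique j) (cong₂ _+_ (cliqueBlock-at-clique j) (joinBlock-at-clique j)) ⟩
    cliqueVertexValue (toℕ j)   ∎
    where open ≡-Reasoning

largestCycleSum : ℕ → ℕ → ℕ
largestCycleSum a k = 2 + m + (n * suc m + n * suc k * m + n * a)
  where
  m n : ℕ
  m = suc (2 * a)
  n = suc (2 * suc k)

smallestCliqueBound : ℕ → ℕ → ℕ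
smallestCliqueBound a k = 2 * suc k * suc (m + m * n) + m * suc m
  where
  m n : ℕ
  m = suc (2 * a)
  n = suc (2 * suc k)

cycleMax<cliqueMin : ∀ a k → 1 ≤ a → largestCycleSum a k < smallestCliqueBound a k
cycleMax<cliqueMin (suc a₀) k _ =
  subst (largestCycleSum (suc a₀) k <_) (sym (gap a₀ k)) (m<m+n (largestCycleSum (suc a₀) k) (s≤s z≤n))
  where
  gap : ∀ a₀ k →
    2 * suc k * suc (suc (2 * suc a₀) + suc (2 * suc a₀) * suc (2 * suc k)) + suc (2 * suc a₀) * suc (suc (2 * suc a₀))
    ≡ 2 + suc (2 * suc a₀) + (suc (2 * suc k) * suc (suc (2 * suc a₀)) + suc (2 * suc k) * suc k * suc (2 * suc a₀)
                              + suc (2 * suc k) * suc a₀)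
      + suc (4 * suc a₀ * (suc k * suc k) + 2 * (k * k) + 5 * k + 4 * (suc a₀ * suc a₀) + a₀)
  gap = solve-∀

module Separation (a k : ℕ) (a≥1 : 1 ≤ a) where

  open CycleLabels a
  open JoinOffsets a
  open Construction a k a≥1
  open JoinEdges m n

  -- each step t ↦ t + 1 raises every join label of the column by m
  joinColumn-step : ∀ t → joinColumn t < joinColumn (suc t)
  joinColumn-step t = ∑-mono-< {2 * a} (λ i → s≤s (begin-strict
    m + t * m + offset t (toℕ i)             <⟨ +-monoʳ-< (m + t * m) (offset<m t i) ⟩
    m + t * m + m                            ≡⟨ +-comm (m + t * m) m ⟩
    m + suc t * m                            ≤⟨ m≤m+n _ _ ⟩
    m + suc t * m + offset (suc t) (toℕ i)   ∎))
    where open ≤-Reasoning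

  cliqueWeight-< : ∀ {x t} → x < t → cliqueWeight x t ≡ suc (cliqueLabel x t)
  cliqueWeight-< {x} {t} lt = cong₂ (λ c d → (if c then suc (cliqueLabel t x) else 0) + (if d then suc (cliqueLabel x t) else 0))
    (does-no (<-asym lt) (t ℕ.<? x)) (does-yes lt (x ℕ.<? t))

  cliqueWeight-> : ∀ {x t} → t < x → cliqueWeight x t ≡ suc (cliqueLabel t x)
  cliqueWeight-> {x} {t} lt = trans (cong₂ (λ c d → (if c then suc (cliqueLabel t x) else 0) + (if d then suc (cliqueLabel x t) else 0))
    (does-yes lt (t ℕ.<? x)) (does-no (<-asym lt) (x ℕ.<? t))) (+-identityʳ _)

  cliqueWeight-≡ : ∀ t → cliqueWeight t t ≡ 0
  cliqueWeight-≡ t = cong₂ (λ c d → (if c then suc (cliqueLabel t t) else 0) + (if d then suc (cliqueLabel t t) else 0))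
    (does-no (<-irrefl refl) (t ℕ.<? t)) (does-no (<-irrefl refl) (t ℕ.<? t))

  -- Stepping from t to t + 1 raises the label of every clique edge {x, t} with
  -- x ∉ {t, t + 1}; the edge {t, t + 1} is counted at both ends, so adding its
  -- weight e once on each side makes the comparison pointwise.
  cliqueSum-mono : ∀ t → suc t < n → cliqueSum t ≤ cliqueSum (suc t)
  cliqueSum-mono t st<n = +-cancelʳ-≤ e (cliqueSum t) (cliqueSum (suc t)) (begin
    cliqueSum t + e                                      ≡⟨ sym (withEdge t (<-trans (n<1+n t) st<n)) ⟩
    ∑[ x < n ] (cliqueWeight (toℕ x) t + at t (toℕ x))   ≤⟨ ∑-mono-≤ {n} (λ x → pointwise (toℕ x)) ⟩
    ∑[ x < n ] (cliqueWeight (toℕ x) (suc t) + at (suc t) (toℕ x))  ≡⟨ withEdge (suc t) st<n ⟩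
    cliqueSum (suc t) + e                                ∎)
    where
    open ≤-Reasoning
    e : ℕ
    e = suc (cliqueLabel t (suc t))
    at : ℕ → ℕ → ℕ
    at s x = if does (x ℕ.≟ s) then e else 0
    withEdge : ∀ s → s < n → ∑[ x < n ] (cliqueWeight (toℕ x) s + at s (toℕ x)) ≡ cliqueSum s + e
    withEdge s s<n = trans (∑-distrib-+ {n} (λ x → cliqueWeight (toℕ x) s) (λ x → at s (toℕ x)))
                           (cong (cliqueSum s +_) (∑-pickℕ s s<n e))
    pointwise : ∀ x → cliqueWeight x t + at t x ≤ cliqueWeight x (suc t) + at (suc t) x
    pointwise x with <-cmp x t
    ... | tri< x<t _ _
      rewrite cliqueWeight-< x<t | cliqueWeight-< (m<n⇒m<1+n x<t)
            | does-no (<⇒≢ x<t) (x ℕ.≟ t) | does-no (<⇒≢ (m<n⇒m<1+n x<t)) (x ℕ.≟ suc t)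
      = +-monoˡ-≤ 0 (s≤s (+-monoʳ-≤ B (+-monoˡ-≤ x (m≤m+n (tri t) t))))
    ... | tri≈ _ refl _
      rewrite cliqueWeight-≡ x | cliqueWeight-< (n<1+n x)
            | does-yes refl (x ℕ.≟ x) | does-no (<⇒≢ (n<1+n x)) (x ℕ.≟ suc x)
      = ≤-reflexive (sym (+-identityʳ e))
    ... | tri> _ _ t<x with <-cmp x (suc t)
    ...   | tri< x<st _ _ = ⊥-elim (<-irrefl refl (<-≤-trans t<x (ℕ.s≤s⁻¹ x<st)))
    ...   | tri≈ _ refl _
      rewrite cliqueWeight-> t<x | cliqueWeight-≡ (suc t)
            | does-no (>⇒≢ t<x) (suc t ℕ.≟ t) | does-yes refl (suc t ℕ.≟ suc t)
      = ≤-reflexive (+-identityʳ e)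
    ...   | tri> _ _ st<x
      rewrite cliqueWeight-> t<x | cliqueWeight-> st<x
            | does-no (>⇒≢ t<x) (x ℕ.≟ t) | does-no (>⇒≢ st<x) (x ℕ.≟ suc t)
      = +-monoˡ-≤ 0 (s≤s (+-monoʳ-≤ B (+-monoʳ-≤ (tri x) (n≤1+n t))))

  cliqueVertexValue-step : ∀ t → suc t < n → cliqueVertexValue t < cliqueVertexValue (suc t)
  cliqueVertexValue-step t lt = +-mono-≤-< (cliqueSum-mono t lt) (joinColumn-step t)

  cliqueVertexValue-mono : ∀ {t t'} → t < t' → t' < n → cliqueVertexValue t < cliqueVertexValue t'
  cliqueVertexValue-mono {t} {suc t'} t<st' st'<n with m≤n⇒m<n∨m≡n (ℕ.s≤s⁻¹ t<st')
  ... | inj₁ t<t' = <-trans (cliqueVertexValue-mono t<t' (<-trans (n<1+n t') st'<n)) (cliqueVertexValue-step t' st'<n)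
  ... | inj₂ refl = cliqueVertexValue-step t st'<n

  -- the smallest clique value: 2b edges of label ≥ B and m join edges of label ≥ m
  cliqueVertexValue-0 : 2 * b * suc B + m * suc m ≤ cliqueVertexValue 0
  cliqueVertexValue-0 = +-mono-≤ cliquePart joinPart
    where
    cliquePart : 2 * b * suc B ≤ cliqueSum 0
    cliquePart = subst (_≤ cliqueSum 0) (∑-const (2 * b) (suc B))
      (∑-mono-≤ {2 * b} {g' = λ x → cliqueWeight (suc (toℕ x)) 0} (λ x →
      subst (suc B ≤_) (sym (cliqueWeight-> {suc (toℕ x)} {0} (s≤s z≤n))) (s≤s (m≤m+n B _))))
    joinPart : m * suc m ≤ joinColumn 0
    joinPart = subst (_≤ joinColumn 0) (∑-const m (suc m)) (∑-mono-≤ {m} {g' = λ i → suc (joinLabel (toℕ i) 0)} (λ i →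
      s≤s (≤-trans (m≤m+n m 0) (m≤m+n (m + 0) (toℕ i)))))

  cycle<clique : ∀ (i : Fin m) t → t < n → 2 + cycleColour (toℕ i) + R < cliqueVertexValue t
  cycle<clique i t t<n = begin-strict
    2 + cycleColour (toℕ i) + R   ≤⟨ +-monoˡ-≤ R (s≤s (s≤s (cycleColour-≤ (toℕ i)))) ⟩
    2 + m + R                     <⟨ cycleMax<cliqueMin a k a≥1 ⟩
    2 * b * suc B + m * suc m     ≤⟨ cliqueVertexValue-0 ⟩
    cliqueVertexValue 0           ≤⟨ lowest t t<n ⟩
    cliqueVertexValue t           ∎
    where
    open ≤-Reasoning
    lowest : ∀ t → t < n → cliqueVertexValue 0 ≤ cliqueVertexValue t
    lowest zero _ = ≤-refl
    lowest (suc t) st<n = <⇒≤ (cliqueVertexValue-mono (s≤s z≤n) st<n)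

  cycleSum-colour : ∀ (i i' : Fin m) → fplus G f (i ↑ˡ n) ≡ fplus G f (i' ↑ˡ n) →
    cycleColour (toℕ i) ≡ cycleColour (toℕ i')
  cycleSum-colour i i' eq = suc-injective (suc-injective (+-cancelʳ-≡ R _ _
    (trans (sym (cycleVertexSum i)) (trans eq (cycleVertexSum i')))))

  cycleEnds : ∀ (k : Fin m) → fplus G f (k ↑ˡ n) ≢ fplus G f (next k ↑ˡ n)
  cycleEnds k eq = apart (m≤n⇒m<n∨m≡n (i≤2a k))
    where
    sameColour : cycleColour (toℕ k) ≡ cycleColour (toℕ (next k))
    sameColour = cycleSum-colour k (next k) eq
    apart : toℕ k < 2 * a ⊎ toℕ k ≡ 2 * a → ⊥
    apart (inj₁ k<2a) = cycleColour-step a≥1 (toℕ k) (trans sameColour (cong cycleColour (next-step k (s≤s k<2a))))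
    apart (inj₂ k≡2a) = cycleColour-wrap a≥1
      (trans (cong cycleColour (sym k≡2a)) (trans sameColour (cong cycleColour (next-wrap k k≡2a))))

  distinctEnds : ∀ {p} → EdgeKind p → fplus G f (proj₁ p) ≢ fplus G f (proj₂ p)
  distinctEnds (cycleEdge k) = cycleEnds k
  distinctEnds (cliqueEdge x y x<y) eq = <-irrefl (trans (sym (cliqueVertexSum x)) (trans eq (cliqueVertexSum y)))
    (cliqueVertexValue-mono x<y (FP.toℕ<n y))
  distinctEnds (joinEdge i j) eq = <-irrefl (trans (sym (cycleVertexSum i)) (trans eq (cliqueVertexSum j)))
    (cycle<clique i (toℕ j) (FP.toℕ<n j))

  f-antimagic : ∀ u v → Adjacent G u v → fplus G f u ≢ fplus G f v
  f-antimagic u v (e , inj₁ ends≡) = distinctEnds (subst EdgeKind ends≡ (edgeKind (∈-lookup e)))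
  f-antimagic u v (e , inj₂ ends≡) = ≢-sym (distinctEnds (subst EdgeKind ends≡ (edgeKind (∈-lookup e))))

  f-colours : colours G f ≤ n + 3
  f-colours = subst (colours G f ≤_) (trans (cong (3 +_) (length-tabulate value)) (+-comm 3 n))
    (colours-≤ G f candidates covered)
    where
    value : Fin n → ℕ
    value j = cliqueVertexValue (toℕ j)
    candidates : List ℕ
    candidates = (2 + a + R) ∷ (2 + 2 * a + R) ∷ (2 + suc (2 * a) + R) ∷ tabulate value
    cycleCovered : ∀ (i : Fin m) → fplus G f (i ↑ˡ n) ∈ candidates
    cycleCovered i = place (cycleColour-values (toℕ i))
      where
      sum≡ : ∀ {c} → cycleColour (toℕ i) ≡ c → fplus G f (i ↑ˡ n) ≡ 2 + c + R
      sum≡ e = trans (cycleVertexSum i) (cong (λ z → 2 + z + R) e)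
      place : cycleColour (toℕ i) ≡ a ⊎ cycleColour (toℕ i) ≡ 2 * a ⊎ cycleColour (toℕ i) ≡ suc (2 * a) →
        fplus G f (i ↑ˡ n) ∈ candidates
      place (inj₁ e) = here (sum≡ e)
      place (inj₂ (inj₁ e)) = there (here (sum≡ e))
      place (inj₂ (inj₂ e)) = there (there (here (sum≡ e)))
    cliqueCovered : ∀ (j : Fin n) → fplus G f (m ↑ʳ j) ∈ candidates
    cliqueCovered j = there (there (there (subst (_∈ tabulate value) (sym (cliqueVertexSum j)) (∈-tabulate⁺ {f = value} j))))
    covered : ∀ u → fplus G f u ∈ candidates
    covered u = side (vertexKind u)
      where
      side : (∃ λ i → u ≡ i ↑ˡ n) ⊎ (∃ λ j → u ≡ m ↑ʳ j) → fplus G f u ∈ candidates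
      side (inj₁ (i , u≡)) = subst (λ v → fplus G f v ∈ candidates) (sym u≡) (cycleCovered i)
      side (inj₂ (j , u≡)) = subst (λ v → fplus G f v ∈ candidates) (sym u≡) (cliqueCovered j)

  f-localAntimagic : IsLocalAntimagic G f
  f-localAntimagic = f-bijective , f-antimagic

mainTheorem7 : ∀ (m n : ℕ) → Odd m → Odd n → 3 ≤ m → 3 ≤ n →
    χla≡ (Join (Cycle m) (Complete n)) (n + 3)
mainTheorem7 _ _ (zero , refl) _ (s≤s ()) _                -- m = 1 < 3
mainTheorem7 _ _ (suc _ , refl) (zero , refl) _ (s≤s ())   -- n = 1 < 3
mainTheorem7 _ n (suc a₀ , refl) (suc k , refl) _ _ =
  (f , f-localAntimagic , ≤-antisym f-colours (lowerBound f f-localAntimagic)) , lowerBound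
  where
  open LowerBound (suc a₀) n (s≤s z≤n) using (lowerBound)
  open Construction (suc a₀) k (s≤s z≤n) using (f)
  open Separation (suc a₀) k (s≤s z≤n) using (f-localAntimagic; f-colours)
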